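{- Let $p$ be an odd prime, $R=\mathrm{GR}(p^t,s)$ and $G=R\times R$. Then $S=\{(x,x^2)\mid x\in R\}$ is a generalized relative difference set in $G$ relative to $\{R_i\times(p^i)\mid 0\le i\le t\}$.
   Context: $\mathrm{GR}(p^t,s)=\mathbb{Z}_{p^t}[x]/(f(x))$ where $f$ is monic of degree $s$ with irreducible reduction mod $p$; $G$ is regarded as an additive group. Write $(p^i)=p^iR$, $R_i=(p^i)\setminus(p^{i+1})$ for $0\le i\le t-1$, $R_t=\{0\}$, and $v_p(a)=i$ iff $a\in R_i$. For $A\subseteq G$, $\nu_A(g)=|\{(a_1,a_2)\in A\times A\mid g=a_1-a_2\}|$. $S\subseteq G$ is a generalized relative difference set relative to $\{R_i\times(p^i)\mid 0\le i\le t\}$ if $\nu_S((a,b))=p^{v_p(a)s}$ whenever $v_p(a)\le v_p(b)$ and $\nu_S((a,b))=0$ whenever $v_p(a)>v_p(b)$. -}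

module Defs where

open import Data.Nat using (ℕ; zero; suc; _+_; _*_; _∸_; _^_; _≤_; _<_; NonZero)
open import Data.Nat.Properties using (m^n≢0)
open import Data.Nat.DivMod using (_%_; _mod_)
open import Data.Nat.ListAction using (sum)
open import Data.Nat.Primality using (Prime; prime⇒nonZero)
open import Data.Fin as Fin using (Fin; toℕ)
open import Data.Fin.Properties as FinP using ()
open import Data.Vec as Vec using (Vec; []; _∷_)
import Data.Vec.Properties as VecP
open import Data.List as List using (List; []; _∷_; length; filter; upTo; allFin; concatMap; cartesianProduct)
open import Data.Product using (_×_; _,_; Σ)
open import Data.Product.Properties as ProdP using ()
open import Data.Sum using (_⊎_)
open import Relation.Nullary using (¬_; Dec; yes; no)
open import Relation.Nullary.Decidable using (_×-dec_)
open import Relation.Binary.PropositionalEquality using (_≡_; _≢_)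

-- Polynomials over ℤ/pℤ, as coefficient lists of naturals read mod p
-- (coefficient k of the list; 0 beyond the end).

coeffAt : List ℕ → ℕ → ℕ
coeffAt []       _       = 0
coeffAt (a ∷ as) zero    = a
coeffAt (a ∷ as) (suc k) = coeffAt as k

-- k-th coefficient of the product g·h (over ℤ; reduced mod p when compared)
mulCoeff : List ℕ → List ℕ → ℕ → ℕ
mulCoeff g h k = sum (List.map (λ i → coeffAt g i * coeffAt h (k ∸ i)) (upTo (suc k)))

module PolyModP (p : ℕ) .{{_ : NonZero p}} where
  IsZeroₚ : List ℕ → Set
  IsZeroₚ g = ∀ k → coeffAt g k % p ≡ 0

  IsUnitₚ : List ℕ → Set
  IsUnitₚ g = (coeffAt g 0 % p ≢ 0) × (∀ k → coeffAt g (suc k) % p ≡ 0)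

  IsProductₚ : List ℕ → List ℕ → List ℕ → Set
  IsProductₚ f g h = ∀ k → coeffAt f k % p ≡ mulCoeff g h k % p

  Irreducibleₚ : List ℕ → Set
  Irreducibleₚ f = ¬ IsZeroₚ f × ¬ IsUnitₚ f
                 × (∀ g h → IsProductₚ f g h → IsUnitₚ g ⊎ IsUnitₚ h)

-- The monic polynomial f(x) = x^s + c_{s-1} x^{s-1} + … + c_0 over ℤ_{p^t},
-- given by its lower coefficients c = (c_0,…,c_{s-1}).

monicCoeffs : ∀ {q s} → Vec (Fin q) s → List ℕ
monicCoeffs c = List.map toℕ (Vec.toList c) List.++ (1 ∷ [])

IrredModP : (p : ℕ) → Prime p → (t s : ℕ) → Vec (Fin (p ^ t)) s → Set
IrredModP p pp t s c = PolyModP.Irreducibleₚ p {{prime⇒nonZero pp}} (monicCoeffs c)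

shiftUp : ∀ {A : Set} {n} → A → Vec A n → Vec A n × A
shiftUp z []       = [] , z
shiftUp z (a ∷ as) with shiftUp a as
... | bs , top = (z ∷ bs) , top

allVec : (q n : ℕ) → List (Vec (Fin q) n)
allVec q zero    = [] ∷ []
allVec q (suc n) = concatMap (λ x → List.map (x ∷_) (allVec q n)) (allFin q)

-- The Galois ring R = GR(p^t, s) = ℤ_{p^t}[x]/(f(x)); an element is the
-- coefficient vector (a_0,…,a_{s-1}) of its representative of degree < s.

module GR (p : ℕ) (pp : Prime p) (t s : ℕ) (c : Vec (Fin (p ^ t)) s) where
  q : ℕ
  q = p ^ t

  instance
    nzp : NonZero p
    nzp = prime⇒nonZero pp
    nzq : NonZero q
    nzq = m^n≢0 p t

  _+q_ _*q_ : Fin q → Fin q → Fin q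
  a +q b = (toℕ a + toℕ b) mod q
  a *q b = (toℕ a * toℕ b) mod q

  -q_ : Fin q → Fin q
  -q a = (q ∸ toℕ a) mod q

  0q : Fin q
  0q = 0 mod q

  R : Set
  R = Vec (Fin q) s

  0R : R
  0R = Vec.replicate s 0q

  _+R_ : R → R → R
  a +R b = Vec.zipWith _+q_ a b

  -R_ : R → R
  -R a = Vec.map -q_ a

  _-R_ : R → R → R
  a -R b = a +R (-R b)

  _·R_ : ℕ → R → R
  n ·R a = Vec.map (λ x → (n mod q) *q x) a

  scal : Fin q → R → R
  scal k a = Vec.map (k *q_) a

  -- multiplication by x, using x^s = -(c_0 + c_1 x + … + c_{s-1} x^{s-1})
  xMul : R → R
  xMul a with shiftUp 0q a
  ... | bs , top = bs +R scal (-q top) c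

  _*R_ : R → R → R
  a *R b = Vec.foldr (λ _ → R) (λ bj acc → scal bj a +R xMul acc) 0R b

  InIdeal : ℕ → R → Set
  InIdeal i a = Σ R (λ r → a ≡ (p ^ i) ·R r)

  InR : ℕ → R → Set
  InR i a = (i < t × InIdeal i a × ¬ InIdeal (suc i) a) ⊎ (i ≡ t × a ≡ 0R)

  G : Set
  G = R × R

  _-G_ : G → G → G
  (a , b) -G (a′ , b′) = (a -R a′) , (b -R b′)

  _≟G_ : (x y : G) → Dec (x ≡ y)
  _≟G_ = ProdP.≡-dec (VecP.≡-dec FinP._≟_) (VecP.≡-dec FinP._≟_)

  allR : List R
  allR = allVec q s

  allG : List G
  allG = cartesianProduct allR allR

  ν : (A : G → Set) → ((x : G) → Dec (A x)) → G → ℕ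
  ν A A? g = length (filter (λ (pr : G × G) → let (a₁ , a₂) = pr in
                                  A? a₁ ×-dec A? a₂ ×-dec (g ≟G (a₁ -G a₂)))
                              (cartesianProduct allG allG))

  InS : G → Set
  InS (a , b) = b ≡ a *R a

  InS? : (x : G) → Dec (InS x)
  InS? (a , b) = b ≟R (a *R a)
    where _≟R_ = VecP.≡-dec FinP._≟_

  νS : G → ℕ
  νS = ν InS InS?

  IsGRDS : Set
  IsGRDS = ∀ (a b : R) (i j : ℕ) → i ≤ t → j ≤ t → InR i a → InR j b →
             (i ≤ j → νS (a , b) ≡ p ^ (i * s)) × (j < i → νS (a , b) ≡ 0)

module Submission where

-- For S = {(x, x²)}, νS(a, b) counts the x ∈ R with x² - b = (x - a)², i.e. with 2a·x = a² + b.
-- Write a = pⁱ·r with r a unit modulo p, where i = v_p(a). If b = pⁱ·b′ lies in (pⁱ), the equation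
-- reads pⁱ·(2r·x) = pⁱ·c for a fixed c; since p is odd, x ↦ 2r·x is a bijection of R, so the solutions
-- correspond to the y with pⁱ·y = pⁱ·c, of which there are p^(is). If v_p(b) < i, the equation would
-- force b ∈ (pⁱ), so there are none. Cancellation of 2r is lifted one power of p at a time from
-- R/pR = 𝔽ₚ[x]/(f̄), a domain because f̄ is irreducible: a monic element of least degree in the
-- annihilator of a nonzero element would be a proper factor of f̄.

open import Defs
open import Algebra.Core using (Op₁; Op₂)
open import Algebra.Bundles using (CommutativeRing)
open import Algebra.Structures using (IsCommutativeRing)
open import Algebra.Definitions using (Associative; Commutative; RightIdentity; RightInverse; _DistributesOverˡ_)
open import Algebra.Consequences.Propositional using (comm∧idʳ⇒id; comm∧invʳ⇒inv; comm∧distrˡ⇒distrʳ; comm∧assoc⇒middleFour)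
import Algebra.Properties.Ring as RingProperties
open import Level using (0ℓ)
open import Data.Nat as ℕ using (ℕ; zero; suc; _∸_; _^_; _≤_; _<_; z≤n; s≤s; NonZero)
open import Data.Nat.Primality using (Prime; prime⇒nonZero; prime⇒nonTrivial)
open import Data.Nat.DivMod using (_%_)
open import Relation.Nullary using (¬_; contradiction)
open import Data.Fin using (Fin; toℕ)
open import Data.Product using (_×_; _,_; proj₁; proj₂)
open import Function.Bundles using (_⇔_; mk⇔; Equivalence)
import Function.Properties.Equivalence
open import Relation.Binary.PropositionalEquality
open import Data.Vec as Vec using (Vec)

record CommutativeRing≡ : Set₁ where
  infix  8 -_
  infixl 7 _*_
  infixl 6 _+_
  field
    Carrier : Set
    _+_ _*_ : Op₂ Carrier
    -_      : Op₁ Carrier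
    0# 1#   : Carrier
    isCommutativeRing : IsCommutativeRing _≡_ _+_ _*_ -_ 0# 1#

  open IsCommutativeRing isCommutativeRing public
    hiding (refl; sym; trans; reflexive; isEquivalence; isPartialEquivalence; setoid)

  commutativeRing : CommutativeRing 0ℓ 0ℓ
  commutativeRing = record { isCommutativeRing = isCommutativeRing }

  open RingProperties (CommutativeRing.ring commutativeRing) public

  +-middleFour : ∀ x y z w → (x + y) + (z + w) ≡ (x + z) + (y + w)
  +-middleFour = comm∧assoc⇒middleFour +-comm +-assoc

mkCommutativeRing≡ : {A : Set} (_+_ _*_ : Op₂ A) (-_ : Op₁ A) (0# 1# : A) →
  Associative _≡_ _+_ → Commutative _≡_ _+_ → RightIdentity _≡_ 0# _+_ → RightInverse _≡_ 0# -_ _+_ →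
  Associative _≡_ _*_ → Commutative _≡_ _*_ → RightIdentity _≡_ 1# _*_ → _DistributesOverˡ_ _≡_ _*_ _+_ →
  CommutativeRing≡
mkCommutativeRing≡ {A} _+_ _*_ -_ 0# 1# +-assoc +-comm +-identityʳ -‿inverseʳ *-assoc *-comm *-identityʳ distribˡ = record
  { Carrier = A ; _+_ = _+_ ; _*_ = _*_ ; -_ = -_ ; 0# = 0# ; 1# = 1#
  ; isCommutativeRing = record
    { isRing = record
      { +-isAbelianGroup = record
        { isGroup = record
          { isMonoid = record
            { isSemigroup = record { isMagma = record { isEquivalence = isEquivalence ; ∙-cong = cong₂ _+_ } ; assoc = +-assoc }
            ; identity = comm∧idʳ⇒id +-comm +-identityʳ }
          ; inverse = comm∧invʳ⇒inv +-comm -‿inverseʳ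
          ; ⁻¹-cong = cong -_ }
        ; comm = +-comm }
      ; *-cong = cong₂ _*_
      ; *-assoc = *-assoc
      ; *-identity = comm∧idʳ⇒id *-comm *-identityʳ
      ; distrib = distribˡ , comm∧distrˡ⇒distrʳ *-comm distribˡ }
    ; *-comm = *-comm } }

≡-cong⇔ : ∀ {A : Set} {u u′ v v′ : A} → u ≡ u′ → v ≡ v′ → (u ≡ v) ⇔ (u′ ≡ v′)
≡-cong⇔ refl refl = Function.Properties.Equivalence.refl

module CommutativeRing≡-Properties (R : CommutativeRing≡) where
  open CommutativeRing≡ R
  open import Algebra.Solver.Ring.NaturalCoefficients.Default (CommutativeRing.commutativeSemiring commutativeRing)
  open import Function.Properties.Equivalence using (⇔-setoid)
  open import Relation.Binary.Reasoning.Setoid (⇔-setoid 0ℓ)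

  -‿shift⇔ : ∀ x y z → x - y ≡ z ⇔ x ≡ z + y
  -‿shift⇔ x y z = mk⇔ (λ e → trans (sym (//-rightDividesˡ y x)) (cong (_+ y) e))
                        (λ e → trans (cong (_- y) e) (//-rightDividesʳ y z))

  +-cancelˡ⇔ : ∀ x y z → x + y ≡ x + z ⇔ y ≡ z
  +-cancelˡ⇔ x y z = mk⇔ (+-cancelˡ x y z) (cong (x +_))

  +-cancelʳ⇔ : ∀ x y z → y + x ≡ z + x ⇔ y ≡ z
  +-cancelʳ⇔ x y z = mk⇔ (+-cancelʳ x y z) (cong (_+ x))

  x-[x-y]≡y : ∀ x y → x - (x - y) ≡ y
  x-[x-y]≡y x y = trans (cong (x +_) (⁻¹-anti-homo‿- x y)) (trans (sym (+-assoc x y (- x))) (xyx⁻¹≈y x y))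

  x-y≡z⇒y≡x-z : ∀ {x y z} → x - y ≡ z → y ≡ x - z
  x-y≡z⇒y≡x-z {x} {y} x-y≡z = trans (sym (x-[x-y]≡y x y)) (cong (λ w → x - w) x-y≡z)

  xx-b≡[x-a][x-a]⇔[a+a]x≡aa+b : ∀ x a b → (x * x - b ≡ (x - a) * (x - a)) ⇔ ((a + a) * x ≡ a * a + b)
  xx-b≡[x-a][x-a]⇔[a+a]x≡aa+b x a b = begin
    x * x - b ≡ y * y                          ≈⟨ -‿shift⇔ (x * x) b (y * y) ⟩
    x * x ≡ y * y + b                          ≈⟨ ≡-cong⇔ (trans (cong (λ z → z * z) x≡y+a) (square y a)) refl ⟩
    y * y + ((a + a) * y + a * a) ≡ y * y + b  ≈⟨ +-cancelˡ⇔ (y * y) _ b ⟩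
    (a + a) * y + a * a ≡ b                    ≈⟨ Function.Properties.Equivalence.sym (+-cancelʳ⇔ (a * a) _ b) ⟩
    (a + a) * y + a * a + a * a ≡ b + a * a    ≈⟨ ≡-cong⇔ (trans (cong ((a + a) *_) x≡y+a) (linear y a)) (+-comm (a * a) b) ⟨
    (a + a) * x ≡ a * a + b                    ∎
    where
      y = x - a
      x≡y+a : x ≡ y + a
      x≡y+a = sym (//-rightDividesˡ a x)
      square : ∀ y a → (y + a) * (y + a) ≡ y * y + ((a + a) * y + a * a)
      square = solve 2 (λ y a → (y :+ a) :* (y :+ a) := y :* y :+ ((a :+ a) :* y :+ a :* a)) refl
      linear : ∀ y a → (a + a) * (y + a) ≡ (a + a) * y + a * a + a * a
      linear = solve 2 (λ y a → (a :+ a) :* (y :+ a) := (a :+ a) :* y :+ a :* a :+ a :* a) refl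

module ZMod (n : ℕ) .{{_ : NonZero n}} where
  open import Data.Nat using (_+_; _*_; >-nonZero⁻¹)
  open import Data.Nat.Properties
  open import Data.Nat.DivMod
  open import Data.Fin.Properties using (toℕ-injective; toℕ<n; toℕ-fromℕ<)
  open ≡-Reasoning

  infixl 6 _+q_
  infixl 7 _*q_

  _+q_ _*q_ : Fin n → Fin n → Fin n
  a +q b = (toℕ a + toℕ b) mod n
  a *q b = (toℕ a * toℕ b) mod n

  -q_ : Fin n → Fin n
  -q a = (n ∸ toℕ a) mod n

  0q 1q : Fin n
  0q = 0 mod n
  1q = 1 mod n

  toℕ-mod : ∀ m → toℕ (m mod n) ≡ m % n
  toℕ-mod m = toℕ-fromℕ< (m%n<n m n)

  mod-cong : ∀ {x y} → x % n ≡ y % n → x mod n ≡ y mod n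
  mod-cong {x} {y} e = toℕ-injective (trans (toℕ-mod x) (trans e (sym (toℕ-mod y))))

  toℕ%n : (a : Fin n) → toℕ a % n ≡ toℕ a
  toℕ%n a = m<n⇒m%n≡m (toℕ<n a)

  0%n≡0 : 0 % n ≡ 0
  0%n≡0 = m<n⇒m%n≡m (>-nonZero⁻¹ n)

  toℕ-0q : toℕ 0q ≡ 0
  toℕ-0q = trans (toℕ-mod 0) 0%n≡0

  %-absorbˡ-+ : ∀ x y → (x % n + y) % n ≡ (x + y) % n
  %-absorbˡ-+ x y = begin
    (x % n + y) % n           ≡⟨ %-distribˡ-+ (x % n) y n ⟩
    (x % n % n + y % n) % n   ≡⟨ cong (λ z → (z + y % n) % n) (m%n%n≡m%n x n) ⟩
    (x % n + y % n) % n       ≡⟨ %-distribˡ-+ x y n ⟨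
    (x + y) % n               ∎

  %-absorbʳ-+ : ∀ x y → (x + y % n) % n ≡ (x + y) % n
  %-absorbʳ-+ x y = begin
    (x + y % n) % n ≡⟨ cong (_% n) (+-comm x (y % n)) ⟩
    (y % n + x) % n ≡⟨ %-absorbˡ-+ y x ⟩
    (y + x) % n     ≡⟨ cong (_% n) (+-comm y x) ⟩
    (x + y) % n     ∎

  %-absorbˡ-* : ∀ x y → (x % n * y) % n ≡ (x * y) % n
  %-absorbˡ-* x y = begin
    (x % n * y) % n             ≡⟨ %-distribˡ-* (x % n) y n ⟩
    (x % n % n * (y % n)) % n   ≡⟨ cong (λ z → (z * (y % n)) % n) (m%n%n≡m%n x n) ⟩
    (x % n * (y % n)) % n       ≡⟨ %-distribˡ-* x y n ⟨
    (x * y) % n                 ∎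

  %-absorbʳ-* : ∀ x y → (x * (y % n)) % n ≡ (x * y) % n
  %-absorbʳ-* x y = begin
    (x * (y % n)) % n ≡⟨ cong (_% n) (*-comm x (y % n)) ⟩
    (y % n * x) % n   ≡⟨ %-absorbˡ-* y x ⟩
    (y * x) % n       ≡⟨ cong (_% n) (*-comm y x) ⟩
    (x * y) % n       ∎

  toℕ-+q : ∀ a b → toℕ (a +q b) ≡ (toℕ a + toℕ b) % n
  toℕ-+q a b = toℕ-mod _

  toℕ-*q : ∀ a b → toℕ (a *q b) ≡ (toℕ a * toℕ b) % n
  toℕ-*q a b = toℕ-mod _

  +q-assoc : ∀ x y z → (x +q y) +q z ≡ x +q (y +q z)
  +q-assoc x y z = mod-cong (begin
    (toℕ (x +q y) + toℕ z) % n                ≡⟨ cong (λ w → (w + toℕ z) % n) (toℕ-+q x y) ⟩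
    ((toℕ x + toℕ y) % n + toℕ z) % n         ≡⟨ %-absorbˡ-+ _ _ ⟩
    (toℕ x + toℕ y + toℕ z) % n               ≡⟨ cong (_% n) (+-assoc (toℕ x) _ _) ⟩
    (toℕ x + (toℕ y + toℕ z)) % n             ≡⟨ %-absorbʳ-+ _ _ ⟨
    (toℕ x + (toℕ y + toℕ z) % n) % n         ≡⟨ cong (λ w → (toℕ x + w) % n) (toℕ-+q y z) ⟨
    (toℕ x + toℕ (y +q z)) % n                ∎)

  +q-comm : ∀ x y → x +q y ≡ y +q x
  +q-comm x y = mod-cong (cong (_% n) (+-comm (toℕ x) (toℕ y)))

  +q-identityʳ : ∀ x → x +q 0q ≡ x
  +q-identityʳ x = toℕ-injective (begin
    toℕ (x +q 0q)            ≡⟨ toℕ-+q x 0q ⟩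
    (toℕ x + toℕ 0q) % n     ≡⟨ cong (λ w → (toℕ x + w) % n) toℕ-0q ⟩
    (toℕ x + 0) % n          ≡⟨ cong (_% n) (+-identityʳ _) ⟩
    toℕ x % n                ≡⟨ toℕ%n x ⟩
    toℕ x                    ∎)

  -q‿inverseʳ : ∀ x → x +q (-q x) ≡ 0q
  -q‿inverseʳ x = mod-cong (begin
    (toℕ x + toℕ (-q x)) % n       ≡⟨ cong (λ w → (toℕ x + w) % n) (toℕ-mod _) ⟩
    (toℕ x + (n ∸ toℕ x) % n) % n  ≡⟨ %-absorbʳ-+ _ _ ⟩
    (toℕ x + (n ∸ toℕ x)) % n      ≡⟨ cong (_% n) (m+[n∸m]≡n (<⇒≤ (toℕ<n x))) ⟩
    n % n                          ≡⟨ n%n≡0 n ⟩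
    0                              ≡⟨ 0%n≡0 ⟨
    0 % n                          ∎)

  *q-assoc : ∀ x y z → (x *q y) *q z ≡ x *q (y *q z)
  *q-assoc x y z = mod-cong (begin
    (toℕ (x *q y) * toℕ z) % n           ≡⟨ cong (λ w → (w * toℕ z) % n) (toℕ-*q x y) ⟩
    ((toℕ x * toℕ y) % n * toℕ z) % n    ≡⟨ %-absorbˡ-* (toℕ x * toℕ y) (toℕ z) ⟩
    (toℕ x * toℕ y * toℕ z) % n          ≡⟨ cong (_% n) (*-assoc (toℕ x) _ _) ⟩
    (toℕ x * (toℕ y * toℕ z)) % n        ≡⟨ %-absorbʳ-* (toℕ x) (toℕ y * toℕ z) ⟨
    (toℕ x * ((toℕ y * toℕ z) % n)) % n  ≡⟨ cong (λ w → (toℕ x * w) % n) (toℕ-*q y z) ⟨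
    (toℕ x * toℕ (y *q z)) % n           ∎)

  *q-comm : ∀ x y → x *q y ≡ y *q x
  *q-comm x y = mod-cong (cong (_% n) (*-comm (toℕ x) (toℕ y)))

  *q-identityʳ : ∀ x → x *q 1q ≡ x
  *q-identityʳ x = toℕ-injective (begin
    toℕ (x *q 1q)            ≡⟨ toℕ-*q x 1q ⟩
    (toℕ x * toℕ 1q) % n     ≡⟨ cong (λ w → (toℕ x * w) % n) (toℕ-mod 1) ⟩
    (toℕ x * (1 % n)) % n    ≡⟨ %-absorbʳ-* (toℕ x) 1 ⟩
    (toℕ x * 1) % n          ≡⟨ cong (_% n) (*-identityʳ _) ⟩
    toℕ x % n                ≡⟨ toℕ%n x ⟩
    toℕ x                    ∎)

  *q-distribˡ-+q : ∀ x y z → x *q (y +q z) ≡ x *q y +q x *q z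
  *q-distribˡ-+q x y z = mod-cong (begin
    (toℕ x * toℕ (y +q z)) % n                          ≡⟨ cong (λ w → (toℕ x * w) % n) (toℕ-+q y z) ⟩
    (toℕ x * ((toℕ y + toℕ z) % n)) % n                 ≡⟨ %-absorbʳ-* (toℕ x) (toℕ y + toℕ z) ⟩
    (toℕ x * (toℕ y + toℕ z)) % n                       ≡⟨ cong (_% n) (*-distribˡ-+ (toℕ x) _ _) ⟩
    (toℕ x * toℕ y + toℕ x * toℕ z) % n                 ≡⟨ %-absorbˡ-+ (toℕ x * toℕ y) (toℕ x * toℕ z) ⟨
    ((toℕ x * toℕ y) % n + toℕ x * toℕ z) % n           ≡⟨ %-absorbʳ-+ ((toℕ x * toℕ y) % n) (toℕ x * toℕ z) ⟨
    ((toℕ x * toℕ y) % n + (toℕ x * toℕ z) % n) % n     ≡⟨ cong₂ (λ u v → (u + v) % n) (toℕ-*q x y) (toℕ-*q x z) ⟨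
    (toℕ (x *q y) + toℕ (x *q z)) % n                   ∎)

  ring : CommutativeRing≡
  ring = mkCommutativeRing≡ _+q_ _*q_ -q_ 0q 1q
    +q-assoc +q-comm +q-identityʳ -q‿inverseʳ *q-assoc *q-comm *q-identityʳ *q-distribˡ-+q

module Vectors (F : CommutativeRing≡) where
  open CommutativeRing≡ F
  open import Algebra.Bundles using (AbelianGroup)
  import Algebra.Properties.AbelianGroup as AbelianGroupProperties
  open import Data.Vec using (Vec; []; _∷_; zipWith; map; replicate)
  open import Data.Vec.Properties
    using (zipWith-assoc; zipWith-comm; zipWith-identityˡ; zipWith-identityʳ; zipWith-inverseˡ; zipWith-inverseʳ)
  open import Data.Product using (_,_; proj₁; proj₂)
  open ≡-Reasoning

  infixl 6 _+ᵛ_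
  infixr 7 _·_

  _+ᵛ_ : ∀ {n} → Op₂ (Vec Carrier n)
  _+ᵛ_ = zipWith _+_

  -ᵛ_ : ∀ {n} → Op₁ (Vec Carrier n)
  -ᵛ_ = map (λ x → - x)

  0ᵛ : ∀ {n} → Vec Carrier n
  0ᵛ {n} = replicate n 0#

  _·_ : ∀ {n} → Carrier → Vec Carrier n → Vec Carrier n
  k · v = map (k *_) v

  +ᵛ-abelianGroup : ℕ → AbelianGroup 0ℓ 0ℓ
  +ᵛ-abelianGroup n = record
    { Carrier = Vec Carrier n ; _≈_ = _≡_ ; _∙_ = _+ᵛ_ ; ε = 0ᵛ ; _⁻¹ = -ᵛ_
    ; isAbelianGroup = record
      { isGroup = record
        { isMonoid = record
          { isSemigroup = record
            { isMagma = record { isEquivalence = isEquivalence ; ∙-cong = cong₂ _+ᵛ_ }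
            ; assoc = zipWith-assoc +-assoc }
          ; identity = zipWith-identityˡ +-identityˡ , zipWith-identityʳ +-identityʳ }
        ; inverse = zipWith-inverseˡ -‿inverseˡ , zipWith-inverseʳ -‿inverseʳ
        ; ⁻¹-cong = cong -ᵛ_ }
      ; comm = zipWith-comm +-comm } }

  module +ᵛ-Properties {n : ℕ} = AbelianGroupProperties (+ᵛ-abelianGroup n)
  open module +ᵛ-AbelianGroup {n : ℕ} = AbelianGroup (+ᵛ-abelianGroup n) public
    using () renaming (assoc to +ᵛ-assoc; comm to +ᵛ-comm; identityˡ to +ᵛ-identityˡ; identityʳ to +ᵛ-identityʳ)

  +ᵛ-middleFour : ∀ {n} (u v w x : Vec Carrier n) → (u +ᵛ v) +ᵛ (w +ᵛ x) ≡ (u +ᵛ w) +ᵛ (v +ᵛ x)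
  +ᵛ-middleFour = comm∧assoc⇒middleFour +ᵛ-comm +ᵛ-assoc

  ·-distribˡ-+ᵛ : ∀ {n} k (u v : Vec Carrier n) → k · (u +ᵛ v) ≡ k · u +ᵛ k · v
  ·-distribˡ-+ᵛ k []      []      = refl
  ·-distribˡ-+ᵛ k (a ∷ u) (b ∷ v) = cong₂ _∷_ (distribˡ k a b) (·-distribˡ-+ᵛ k u v)

  ·-distribʳ-+ : ∀ {n} k l (u : Vec Carrier n) → (k + l) · u ≡ k · u +ᵛ l · u
  ·-distribʳ-+ k l []      = refl
  ·-distribʳ-+ k l (a ∷ u) = cong₂ _∷_ (distribʳ a k l) (·-distribʳ-+ k l u)

  ·-assoc : ∀ {n} k l (u : Vec Carrier n) → k · l · u ≡ (k * l) · u
  ·-assoc k l []      = refl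
  ·-assoc k l (a ∷ u) = cong₂ _∷_ (sym (*-assoc k l a)) (·-assoc k l u)

  ·-comm : ∀ {n} k l (u : Vec Carrier n) → k · l · u ≡ l · k · u
  ·-comm k l u = trans (·-assoc k l u) (trans (cong (_· u) (*-comm k l)) (sym (·-assoc l k u)))

  ·-identityˡ : ∀ {n} (u : Vec Carrier n) → 1# · u ≡ u
  ·-identityˡ []      = refl
  ·-identityˡ (a ∷ u) = cong₂ _∷_ (*-identityˡ a) (·-identityˡ u)

  ·-zeroˡ : ∀ {n} (u : Vec Carrier n) → 0# · u ≡ 0ᵛ
  ·-zeroˡ []      = refl
  ·-zeroˡ (a ∷ u) = cong₂ _∷_ (zeroˡ a) (·-zeroˡ u)

  ·-zeroʳ : ∀ {n} k → k · 0ᵛ {n} ≡ 0ᵛ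
  ·-zeroʳ {zero}  k = refl
  ·-zeroʳ {suc n} k = cong₂ _∷_ (zeroʳ k) (·-zeroʳ k)

  +ᵛ-homo⇒0ᵛ-homo : ∀ {m n} (f : Vec Carrier m → Vec Carrier n) →
                 (∀ u v → f (u +ᵛ v) ≡ f u +ᵛ f v) → f 0ᵛ ≡ 0ᵛ
  +ᵛ-homo⇒0ᵛ-homo f f-+ = +ᵛ-Properties.identityʳ-unique (f 0ᵛ) (f 0ᵛ)
    (trans (sym (f-+ 0ᵛ 0ᵛ)) (cong f (+ᵛ-identityʳ 0ᵛ)))

  shift : ∀ {n} → Carrier → Vec Carrier n → Vec Carrier n
  shift z u = proj₁ (shiftUp z u)

  overflow : ∀ {n} → Carrier → Vec Carrier n → Carrier
  overflow z u = proj₂ (shiftUp z u)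

  shiftUp-∷ : ∀ {n} z a (u : Vec Carrier n) → shiftUp z (a ∷ u) ≡ (z ∷ shift a u , overflow a u)
  shiftUp-∷ z a u with shiftUp a u
  ... | _ , _ = refl

  shift-∷ : ∀ {n} z a (u : Vec Carrier n) → shift z (a ∷ u) ≡ z ∷ shift a u
  shift-∷ z a u = cong proj₁ (shiftUp-∷ z a u)

  overflow-∷ : ∀ {n} z a (u : Vec Carrier n) → overflow z (a ∷ u) ≡ overflow a u
  overflow-∷ z a u = cong proj₂ (shiftUp-∷ z a u)

  shift-+ : ∀ {n} z z′ (u v : Vec Carrier n) → shift (z + z′) (u +ᵛ v) ≡ shift z u +ᵛ shift z′ v
  shift-+ z z′ []      []      = refl
  shift-+ z z′ (a ∷ u) (b ∷ v) = begin
    shift (z + z′) (a + b ∷ u +ᵛ v)  ≡⟨ shift-∷ (z + z′) (a + b) (u +ᵛ v) ⟩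
    z + z′ ∷ shift (a + b) (u +ᵛ v)  ≡⟨ cong (z + z′ ∷_) (shift-+ a b u v) ⟩
    z + z′ ∷ shift a u +ᵛ shift b v  ≡⟨ cong₂ _+ᵛ_ (shift-∷ z a u) (shift-∷ z′ b v) ⟨
    shift z (a ∷ u) +ᵛ shift z′ (b ∷ v) ∎

  overflow-+ : ∀ {n} z z′ (u v : Vec Carrier n) → overflow (z + z′) (u +ᵛ v) ≡ overflow z u + overflow z′ v
  overflow-+ z z′ []      []      = refl
  overflow-+ z z′ (a ∷ u) (b ∷ v) = begin
    overflow (z + z′) (a + b ∷ u +ᵛ v) ≡⟨ overflow-∷ (z + z′) (a + b) (u +ᵛ v) ⟩
    overflow (a + b) (u +ᵛ v)          ≡⟨ overflow-+ a b u v ⟩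
    overflow a u + overflow b v        ≡⟨ cong₂ _+_ (overflow-∷ z a u) (overflow-∷ z′ b v) ⟨
    overflow z (a ∷ u) + overflow z′ (b ∷ v) ∎

  shift-· : ∀ {n} k z (u : Vec Carrier n) → shift (k * z) (k · u) ≡ k · shift z u
  shift-· k z []      = refl
  shift-· k z (a ∷ u) = begin
    shift (k * z) (k * a ∷ k · u) ≡⟨ shift-∷ (k * z) (k * a) (k · u) ⟩
    k * z ∷ shift (k * a) (k · u) ≡⟨ cong (k * z ∷_) (shift-· k a u) ⟩
    k * z ∷ k · shift a u         ≡⟨ cong (k ·_) (shift-∷ z a u) ⟨
    k · shift z (a ∷ u)           ∎

  overflow-· : ∀ {n} k z (u : Vec Carrier n) → overflow (k * z) (k · u) ≡ k * overflow z u
  overflow-· k z []      = refl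
  overflow-· k z (a ∷ u) = begin
    overflow (k * z) (k * a ∷ k · u) ≡⟨ overflow-∷ (k * z) (k * a) (k · u) ⟩
    overflow (k * a) (k · u)         ≡⟨ overflow-· k a u ⟩
    k * overflow a u                 ≡⟨ cong (k *_) (overflow-∷ z a u) ⟨
    k * overflow z (a ∷ u)           ∎

module Quotient (F : CommutativeRing≡) {s : ℕ} (c : Vec (CommutativeRing≡.Carrier F) s) where
  open CommutativeRing≡ F
  open Vectors F
  open import Data.Vec using (Vec; []; _∷_; foldr)
  open ≡-Reasoning

  V : Set
  V = Vec Carrier s

  xMul : V → V
  xMul a = shift 0# a +ᵛ (- overflow 0# a) · c

  infixl 7 _⊛_

  -- v ⊛ b multiplies v by the polynomial with coefficients b, of any length, by Horner's rule as
  -- GR._*R_ does; letting b range over all polynomials is what makes the product commutative.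
  _⊛_ : ∀ {m} → V → Vec Carrier m → V
  v ⊛ b = foldr (λ _ → V) (λ bj acc → bj · v +ᵛ xMul acc) 0ᵛ b

  xMul-+ᵛ : ∀ u v → xMul (u +ᵛ v) ≡ xMul u +ᵛ xMul v
  xMul-+ᵛ u v = begin
    shift 0# (u +ᵛ v) +ᵛ (- overflow 0# (u +ᵛ v)) · c
      ≡⟨ cong (λ z → shift z (u +ᵛ v) +ᵛ (- overflow z (u +ᵛ v)) · c) (sym (+-identityʳ 0#)) ⟩
    shift (0# + 0#) (u +ᵛ v) +ᵛ (- overflow (0# + 0#) (u +ᵛ v)) · c
      ≡⟨ cong₂ (λ x y → x +ᵛ (- y) · c) (shift-+ 0# 0# u v) (overflow-+ 0# 0# u v) ⟩
    (shift 0# u +ᵛ shift 0# v) +ᵛ (- (overflow 0# u + overflow 0# v)) · c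
      ≡⟨ cong (λ y → (shift 0# u +ᵛ shift 0# v) +ᵛ y · c) (sym (-‿+-comm _ _)) ⟩
    (shift 0# u +ᵛ shift 0# v) +ᵛ (- overflow 0# u + - overflow 0# v) · c
      ≡⟨ cong ((shift 0# u +ᵛ shift 0# v) +ᵛ_) (·-distribʳ-+ _ _ c) ⟩
    (shift 0# u +ᵛ shift 0# v) +ᵛ ((- overflow 0# u) · c +ᵛ (- overflow 0# v) · c)
      ≡⟨ +ᵛ-middleFour _ _ _ _ ⟩
    xMul u +ᵛ xMul v ∎

  xMul-· : ∀ k u → xMul (k · u) ≡ k · xMul u
  xMul-· k u = begin
    shift 0# (k · u) +ᵛ (- overflow 0# (k · u)) · c
      ≡⟨ cong (λ z → shift z (k · u) +ᵛ (- overflow z (k · u)) · c) (sym (zeroʳ k)) ⟩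
    shift (k * 0#) (k · u) +ᵛ (- overflow (k * 0#) (k · u)) · c
      ≡⟨ cong₂ (λ x y → x +ᵛ (- y) · c) (shift-· k 0# u) (overflow-· k 0# u) ⟩
    k · shift 0# u +ᵛ (- (k * overflow 0# u)) · c
      ≡⟨ cong (λ y → k · shift 0# u +ᵛ y · c) (-‿distribʳ-* k (overflow 0# u)) ⟩
    k · shift 0# u +ᵛ (k * - overflow 0# u) · c
      ≡⟨ cong (k · shift 0# u +ᵛ_) (sym (·-assoc k _ c)) ⟩
    k · shift 0# u +ᵛ k · (- overflow 0# u) · c
      ≡⟨ sym (·-distribˡ-+ᵛ k _ _) ⟩
    k · xMul u ∎

  xMul-0ᵛ : xMul 0ᵛ ≡ 0ᵛ
  xMul-0ᵛ = +ᵛ-homo⇒0ᵛ-homo xMul xMul-+ᵛ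

  ⊛-zeroˡ : ∀ {m} (b : Vec Carrier m) → 0ᵛ ⊛ b ≡ 0ᵛ
  ⊛-zeroˡ []       = refl
  ⊛-zeroˡ (b0 ∷ b) = begin
    b0 · 0ᵛ +ᵛ xMul (0ᵛ ⊛ b) ≡⟨ cong₂ _+ᵛ_ (·-zeroʳ b0) (trans (cong xMul (⊛-zeroˡ b)) xMul-0ᵛ) ⟩
    0ᵛ +ᵛ 0ᵛ                 ≡⟨ +ᵛ-identityʳ _ ⟩
    0ᵛ                       ∎

  ⊛-zeroʳ : ∀ m (v : V) → v ⊛ 0ᵛ {m} ≡ 0ᵛ
  ⊛-zeroʳ zero    v = refl
  ⊛-zeroʳ (suc m) v = begin
    0# · v +ᵛ xMul (v ⊛ 0ᵛ {m}) ≡⟨ cong₂ _+ᵛ_ (·-zeroˡ v) (trans (cong xMul (⊛-zeroʳ m v)) xMul-0ᵛ) ⟩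
    0ᵛ +ᵛ 0ᵛ                    ≡⟨ +ᵛ-identityʳ _ ⟩
    0ᵛ                          ∎

  ⊛-distribʳ : ∀ {m} (b : Vec Carrier m) u v → (u +ᵛ v) ⊛ b ≡ u ⊛ b +ᵛ v ⊛ b
  ⊛-distribʳ []       u v = sym (+ᵛ-identityʳ _)
  ⊛-distribʳ (b0 ∷ b) u v = begin
    b0 · (u +ᵛ v) +ᵛ xMul ((u +ᵛ v) ⊛ b)
      ≡⟨ cong₂ _+ᵛ_ (·-distribˡ-+ᵛ b0 u v) (trans (cong xMul (⊛-distribʳ b u v)) (xMul-+ᵛ (u ⊛ b) (v ⊛ b))) ⟩
    (b0 · u +ᵛ b0 · v) +ᵛ (xMul (u ⊛ b) +ᵛ xMul (v ⊛ b))
      ≡⟨ +ᵛ-middleFour _ _ _ _ ⟩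
    u ⊛ (b0 ∷ b) +ᵛ v ⊛ (b0 ∷ b) ∎

  ⊛-distribˡ : ∀ {m} (v : V) (a b : Vec Carrier m) → v ⊛ (a +ᵛ b) ≡ v ⊛ a +ᵛ v ⊛ b
  ⊛-distribˡ v []       []       = sym (+ᵛ-identityʳ _)
  ⊛-distribˡ v (a0 ∷ a) (b0 ∷ b) = begin
    (a0 + b0) · v +ᵛ xMul (v ⊛ (a +ᵛ b))
      ≡⟨ cong₂ _+ᵛ_ (·-distribʳ-+ a0 b0 v) (trans (cong xMul (⊛-distribˡ v a b)) (xMul-+ᵛ (v ⊛ a) (v ⊛ b))) ⟩
    (a0 · v +ᵛ b0 · v) +ᵛ (xMul (v ⊛ a) +ᵛ xMul (v ⊛ b))
      ≡⟨ +ᵛ-middleFour _ _ _ _ ⟩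
    v ⊛ (a0 ∷ a) +ᵛ v ⊛ (b0 ∷ b) ∎

  ⊛-·ˡ : ∀ {m} (b : Vec Carrier m) k v → (k · v) ⊛ b ≡ k · (v ⊛ b)
  ⊛-·ˡ []       k v = sym (·-zeroʳ k)
  ⊛-·ˡ (b0 ∷ b) k v = begin
    b0 · k · v +ᵛ xMul ((k · v) ⊛ b)
      ≡⟨ cong₂ _+ᵛ_ (·-comm b0 k v) (trans (cong xMul (⊛-·ˡ b k v)) (xMul-· k (v ⊛ b))) ⟩
    k · b0 · v +ᵛ k · xMul (v ⊛ b)
      ≡⟨ sym (·-distribˡ-+ᵛ k _ _) ⟩
    k · (v ⊛ (b0 ∷ b)) ∎

  ⊛-xMulˡ : ∀ {m} (b : Vec Carrier m) v → xMul v ⊛ b ≡ xMul (v ⊛ b)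
  ⊛-xMulˡ []       v = sym xMul-0ᵛ
  ⊛-xMulˡ (b0 ∷ b) v = begin
    b0 · xMul v +ᵛ xMul (xMul v ⊛ b)   ≡⟨ cong₂ _+ᵛ_ (sym (xMul-· b0 v)) (cong xMul (⊛-xMulˡ b v)) ⟩
    xMul (b0 · v) +ᵛ xMul (xMul (v ⊛ b)) ≡⟨ sym (xMul-+ᵛ (b0 · v) (xMul (v ⊛ b))) ⟩
    xMul (v ⊛ (b0 ∷ b))                ∎

  ⊛-⊛-comm : ∀ {m n} (v : V) (a : Vec Carrier m) (b : Vec Carrier n) → v ⊛ b ⊛ a ≡ v ⊛ a ⊛ b
  ⊛-⊛-comm v a []       = ⊛-zeroˡ a
  ⊛-⊛-comm v a (b0 ∷ b) = begin
    (b0 · v +ᵛ xMul (v ⊛ b)) ⊛ a        ≡⟨ ⊛-distribʳ a _ _ ⟩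
    (b0 · v) ⊛ a +ᵛ xMul (v ⊛ b) ⊛ a    ≡⟨ cong₂ _+ᵛ_ (⊛-·ˡ a b0 v) (trans (⊛-xMulˡ a _) (cong xMul (⊛-⊛-comm v a b))) ⟩
    v ⊛ a ⊛ (b0 ∷ b)                    ∎

module QuotientRing (F : CommutativeRing≡) {k : ℕ} (c : Vec (CommutativeRing≡.Carrier F) (suc k)) where
  open CommutativeRing≡ F
  open Vectors F
  open Quotient F c public
  open import Data.Vec using (Vec; []; _∷_; replicate; padRight)
  open import Data.Vec.Properties using (padRight-refl; zipWith-inverseʳ)
  open import Data.Nat.Properties using (m≤n⇒m≤1+n; ≤-refl)
  open import Data.Product using (_,_)
  open ≡-Reasoning

  shiftUp-replicate : ∀ n z → shiftUp z (replicate (suc n) 0#) ≡ (z ∷ replicate n 0# , 0#)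
  shiftUp-replicate zero    z = refl
  shiftUp-replicate (suc n) z = trans (shiftUp-∷ z 0# (replicate (suc n) 0#))
    (cong (λ pr → (z ∷ proj₁ pr) , proj₂ pr) (shiftUp-replicate n 0#))

  shiftUp-padRight : ∀ {m n} (le : m ≤ n) z (w : Vec Carrier m) →
                     shiftUp z (padRight (m≤n⇒m≤1+n le) 0# w) ≡ (z ∷ padRight le 0# w , 0#)
  shiftUp-padRight {n = n} z≤n z []       = shiftUp-replicate n z
  shiftUp-padRight (s≤s le) z (w0 ∷ w) = trans (shiftUp-∷ z w0 (padRight (m≤n⇒m≤1+n le) 0# w))
    (cong (λ pr → (z ∷ proj₁ pr) , proj₂ pr) (shiftUp-padRight le w0 w))

  xMul-padRight : ∀ {m} (le : m ≤ k) (w : Vec Carrier m) →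
                  xMul (padRight (m≤n⇒m≤1+n le) 0# w) ≡ 0# ∷ padRight le 0# w
  xMul-padRight le w = begin
    xMul (padRight (m≤n⇒m≤1+n le) 0# w)
      ≡⟨ cong (λ pr → proj₁ pr +ᵛ (- proj₂ pr) · c) (shiftUp-padRight le 0# w) ⟩
    (0# ∷ padRight le 0# w) +ᵛ (- 0#) · c ≡⟨ cong (λ z → (0# ∷ padRight le 0# w) +ᵛ z · c) -0#≈0# ⟩
    (0# ∷ padRight le 0# w) +ᵛ 0# · c     ≡⟨ cong ((0# ∷ padRight le 0# w) +ᵛ_) (·-zeroˡ c) ⟩
    (0# ∷ padRight le 0# w) +ᵛ 0ᵛ         ≡⟨ +ᵛ-identityʳ _ ⟩
    0# ∷ padRight le 0# w                 ∎

  1ᵛ : V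
  1ᵛ = 1# ∷ 0ᵛ

  1ᵛ-⊛ : ∀ {m} (le : m ≤ suc k) (w : Vec Carrier m) → 1ᵛ ⊛ w ≡ padRight le 0# w
  1ᵛ-⊛ z≤n      []       = refl
  1ᵛ-⊛ (s≤s le) (w0 ∷ w) = begin
    w0 · 1ᵛ +ᵛ xMul (1ᵛ ⊛ w)
      ≡⟨ cong (λ z → w0 · 1ᵛ +ᵛ xMul z) (1ᵛ-⊛ (m≤n⇒m≤1+n le) w) ⟩
    w0 · 1ᵛ +ᵛ xMul (padRight (m≤n⇒m≤1+n le) 0# w)
      ≡⟨ cong (w0 · 1ᵛ +ᵛ_) (xMul-padRight le w) ⟩
    (w0 * 1# + 0#) ∷ (w0 · 0ᵛ +ᵛ padRight le 0# w)
      ≡⟨ cong₂ (λ x y → (x + 0#) ∷ (y +ᵛ padRight le 0# w)) (*-identityʳ w0) (·-zeroʳ w0) ⟩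
    (w0 + 0#) ∷ (0ᵛ +ᵛ padRight le 0# w)
      ≡⟨ cong₂ _∷_ (+-identityʳ w0) (+ᵛ-identityˡ _) ⟩
    w0 ∷ padRight le 0# w ∎

  ⊛-identityˡ : ∀ a → 1ᵛ ⊛ a ≡ a
  ⊛-identityˡ a = trans (1ᵛ-⊛ ≤-refl a) (padRight-refl 0# a)

  ⊛-identityʳ : ∀ v → v ⊛ 1ᵛ ≡ v
  ⊛-identityʳ v = begin
    1# · v +ᵛ xMul (v ⊛ 0ᵛ {k}) ≡⟨ cong₂ _+ᵛ_ (·-identityˡ v) (trans (cong xMul (⊛-zeroʳ k v)) xMul-0ᵛ) ⟩
    v +ᵛ 0ᵛ                     ≡⟨ +ᵛ-identityʳ v ⟩
    v                           ∎

  ⊛-comm : ∀ (a b : V) → a ⊛ b ≡ b ⊛ a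
  ⊛-comm a b = begin
    a ⊛ b        ≡⟨ cong (_⊛ b) (⊛-identityˡ a) ⟨
    1ᵛ ⊛ a ⊛ b   ≡⟨ ⊛-⊛-comm 1ᵛ a b ⟨
    1ᵛ ⊛ b ⊛ a   ≡⟨ cong (_⊛ a) (⊛-identityˡ b) ⟩
    b ⊛ a        ∎

  ⊛-assoc : ∀ (u v w : V) → u ⊛ v ⊛ w ≡ u ⊛ (v ⊛ w)
  ⊛-assoc u v w = begin
    u ⊛ v ⊛ w    ≡⟨ cong (_⊛ w) (⊛-comm u v) ⟩
    v ⊛ u ⊛ w    ≡⟨ ⊛-⊛-comm v u w ⟨
    v ⊛ w ⊛ u    ≡⟨ ⊛-comm (v ⊛ w) u ⟩
    u ⊛ (v ⊛ w)  ∎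

  ring : CommutativeRing≡
  ring = mkCommutativeRing≡ _+ᵛ_ _⊛_ -ᵛ_ 0ᵛ 1ᵛ
    +ᵛ-assoc +ᵛ-comm +ᵛ-identityʳ (zipWith-inverseʳ -‿inverseʳ) ⊛-assoc ⊛-comm ⊛-identityʳ ⊛-distribˡ

  ·≡⊛constant : ∀ a v → a · v ≡ v ⊛ (a ∷ 0ᵛ {k})
  ·≡⊛constant a v = sym (begin
    a · v +ᵛ xMul (v ⊛ 0ᵛ {k}) ≡⟨ cong (λ z → a · v +ᵛ xMul z) (⊛-zeroʳ k v) ⟩
    a · v +ᵛ xMul 0ᵛ           ≡⟨ cong (a · v +ᵛ_) xMul-0ᵛ ⟩
    a · v +ᵛ 0ᵛ                ≡⟨ +ᵛ-identityʳ _ ⟩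
    a · v                      ∎)

module RingHomomorphism (R S : CommutativeRing≡) (φ : CommutativeRing≡.Carrier R → CommutativeRing≡.Carrier S)
  (φ-+ : ∀ x y → φ (CommutativeRing≡._+_ R x y) ≡ CommutativeRing≡._+_ S (φ x) (φ y))
  (φ-* : ∀ x y → φ (CommutativeRing≡._*_ R x y) ≡ CommutativeRing≡._*_ S (φ x) (φ y))
  (φ-0 : φ (CommutativeRing≡.0# R) ≡ CommutativeRing≡.0# S) where
  private
    module R = CommutativeRing≡ R
    module S = CommutativeRing≡ S
    module VR = Vectors R
    module VS = Vectors S
  open import Data.Vec using (Vec; []; _∷_; map)
  open import Data.Vec.Properties using (map-replicate)
  open ≡-Reasoning

  φ-‿homo : ∀ x → φ (R.- x) ≡ S.- φ x
  φ-‿homo x = S.+-inverseʳ-unique (φ x) (φ (R.- x))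
    (trans (sym (φ-+ x (R.- x))) (trans (cong φ (R.-‿inverseʳ x)) φ-0))

  φᵛ : ∀ {n} → Vec R.Carrier n → Vec S.Carrier n
  φᵛ = map φ

  φᵛ-+ᵛ : ∀ {n} (u v : Vec R.Carrier n) → φᵛ (u VR.+ᵛ v) ≡ φᵛ u VS.+ᵛ φᵛ v
  φᵛ-+ᵛ []      []      = refl
  φᵛ-+ᵛ (a ∷ u) (b ∷ v) = cong₂ _∷_ (φ-+ a b) (φᵛ-+ᵛ u v)

  φᵛ-· : ∀ {n} k (u : Vec R.Carrier n) → φᵛ (k VR.· u) ≡ φ k VS.· φᵛ u
  φᵛ-· k []      = refl
  φᵛ-· k (a ∷ u) = cong₂ _∷_ (φ-* k a) (φᵛ-· k u)

  φᵛ-0ᵛ : ∀ {n} → φᵛ (VR.0ᵛ {n}) ≡ VS.0ᵛ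
  φᵛ-0ᵛ {n} = trans (map-replicate φ R.0# n) (cong (Data.Vec.replicate n) φ-0)

  φᵛ-shift : ∀ {n} z (v : Vec R.Carrier n) → φᵛ (VR.shift z v) ≡ VS.shift (φ z) (φᵛ v)
  φᵛ-shift z []      = refl
  φᵛ-shift z (a ∷ v) = begin
    φᵛ (VR.shift z (a ∷ v))       ≡⟨ cong φᵛ (VR.shift-∷ z a v) ⟩
    φ z ∷ φᵛ (VR.shift a v)       ≡⟨ cong (φ z ∷_) (φᵛ-shift a v) ⟩
    φ z ∷ VS.shift (φ a) (φᵛ v)   ≡⟨ VS.shift-∷ (φ z) (φ a) (φᵛ v) ⟨
    VS.shift (φ z) (φᵛ (a ∷ v))   ∎

  φ-overflow : ∀ {n} z (v : Vec R.Carrier n) → φ (VR.overflow z v) ≡ VS.overflow (φ z) (φᵛ v)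
  φ-overflow z []      = refl
  φ-overflow z (a ∷ v) = begin
    φ (VR.overflow z (a ∷ v))        ≡⟨ cong φ (VR.overflow-∷ z a v) ⟩
    φ (VR.overflow a v)              ≡⟨ φ-overflow a v ⟩
    VS.overflow (φ a) (φᵛ v)         ≡⟨ VS.overflow-∷ (φ z) (φ a) (φᵛ v) ⟨
    VS.overflow (φ z) (φᵛ (a ∷ v))   ∎

  module _ {s} (c : Vec R.Carrier s) where
    private
      module QR = Quotient R c
      module QS = Quotient S (φᵛ c)

    φᵛ-xMul : ∀ v → φᵛ (QR.xMul v) ≡ QS.xMul (φᵛ v)
    φᵛ-xMul v = begin
      φᵛ (VR.shift R.0# v VR.+ᵛ (R.- VR.overflow R.0# v) VR.· c)
        ≡⟨ φᵛ-+ᵛ _ _ ⟩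
      φᵛ (VR.shift R.0# v) VS.+ᵛ φᵛ ((R.- VR.overflow R.0# v) VR.· c)
        ≡⟨ cong₂ VS._+ᵛ_ (φᵛ-shift R.0# v) (φᵛ-· _ c) ⟩
      VS.shift (φ R.0#) (φᵛ v) VS.+ᵛ φ (R.- VR.overflow R.0# v) VS.· φᵛ c
        ≡⟨ cong (λ y → VS.shift (φ R.0#) (φᵛ v) VS.+ᵛ y VS.· φᵛ c) (trans (φ-‿homo _) (cong S.-_ (φ-overflow R.0# v))) ⟩
      VS.shift (φ R.0#) (φᵛ v) VS.+ᵛ (S.- VS.overflow (φ R.0#) (φᵛ v)) VS.· φᵛ c
        ≡⟨ cong (λ z → VS.shift z (φᵛ v) VS.+ᵛ (S.- VS.overflow z (φᵛ v)) VS.· φᵛ c) φ-0 ⟩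
      QS.xMul (φᵛ v) ∎

    φᵛ-⊛ : ∀ {m} v (b : Vec R.Carrier m) → φᵛ (v QR.⊛ b) ≡ φᵛ v QS.⊛ φᵛ b
    φᵛ-⊛ v []       = φᵛ-0ᵛ
    φᵛ-⊛ v (b0 ∷ b) = begin
      φᵛ (b0 VR.· v VR.+ᵛ QR.xMul (v QR.⊛ b))
        ≡⟨ φᵛ-+ᵛ _ _ ⟩
      φᵛ (b0 VR.· v) VS.+ᵛ φᵛ (QR.xMul (v QR.⊛ b))
        ≡⟨ cong₂ VS._+ᵛ_ (φᵛ-· b0 v) (trans (φᵛ-xMul (v QR.⊛ b)) (cong QS.xMul (φᵛ-⊛ v b))) ⟩
      φᵛ v QS.⊛ φᵛ (b0 ∷ b) ∎

module Polynomials (F : CommutativeRing≡) where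
  open CommutativeRing≡ F
  open Vectors F
  open import Data.Nat.Properties using (_≤?_; <-irrefl; <-≤-trans; ≰⇒>)
  open import Data.List using (foldr; applyUpTo)
  open import Data.Vec using (Vec; []; _∷_)
  open import Function using (_∘_)
  open import Relation.Nullary using (yes; no)
  open ≡-Reasoning

  Poly : Set
  Poly = ℕ → Carrier

  DegreeBelow : ℕ → Poly → Set
  DegreeBelow d h = ∀ k → d ≤ k → h k ≡ 0#

  toPoly : ∀ {n} → Vec Carrier n → Poly
  toPoly []      _       = 0#
  toPoly (a ∷ v) zero    = a
  toPoly (a ∷ v) (suc k) = toPoly v k

  monomial : ℕ → Poly
  monomial zero    zero    = 1#
  monomial zero    (suc k) = 0#
  monomial (suc j) zero    = 0#
  monomial (suc j) (suc k) = monomial j k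

  mulX : Poly → Poly
  mulX h zero    = 0#
  mulX h (suc k) = h k

  mulXPow : ℕ → Poly → Poly
  mulXPow zero    h = h
  mulXPow (suc j) h = mulX (mulXPow j h)

  ∑< : ℕ → (ℕ → Carrier) → Carrier
  ∑< n ψ = foldr _+_ 0# (applyUpTo ψ n)

  infixl 7 _⋆_

  _⋆_ : Poly → Poly → Poly
  (g ⋆ h) k = ∑< (suc k) (λ i → g i * h (k ∸ i))

  ∑<-cong : ∀ {φ ψ : ℕ → Carrier} n → (∀ i → i < n → φ i ≡ ψ i) → ∑< n φ ≡ ∑< n ψ
  ∑<-cong zero    e = refl
  ∑<-cong (suc n) e = cong₂ _+_ (e 0 (s≤s z≤n)) (∑<-cong n (λ i i<n → e (suc i) (s≤s i<n)))

  ∑<-+ : ∀ n (φ ψ : ℕ → Carrier) → ∑< n (λ i → φ i + ψ i) ≡ ∑< n φ + ∑< n ψ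
  ∑<-+ zero    φ ψ = sym (+-identityʳ 0#)
  ∑<-+ (suc n) φ ψ = trans (cong (φ 0 + ψ 0 +_) (∑<-+ n (φ ∘ suc) (ψ ∘ suc))) (+-middleFour _ _ _ _)

  ∑<-distribˡ : ∀ n a (φ : ℕ → Carrier) → ∑< n (λ i → a * φ i) ≡ a * ∑< n φ
  ∑<-distribˡ zero    a φ = sym (zeroʳ a)
  ∑<-distribˡ (suc n) a φ = trans (cong (a * φ 0 +_) (∑<-distribˡ n a (φ ∘ suc))) (sym (distribˡ _ _ _))

  ∑<-0 : ∀ n → ∑< n (λ _ → 0#) ≡ 0#
  ∑<-0 zero    = refl
  ∑<-0 (suc n) = trans (+-identityˡ _) (∑<-0 n)

  monomial-≢ : ∀ {j k} → j ≢ k → monomial j k ≡ 0#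
  monomial-≢ {zero}  {zero}  j≢k = contradiction refl j≢k
  monomial-≢ {zero}  {suc k} j≢k = refl
  monomial-≢ {suc j} {zero}  j≢k = refl
  monomial-≢ {suc j} {suc k} j≢k = monomial-≢ (j≢k ∘ cong suc)

  monomial-≡ : ∀ j → monomial j j ≡ 1#
  monomial-≡ zero    = refl
  monomial-≡ (suc j) = monomial-≡ j

  ∑<-monomial : ∀ j n (ψ : ℕ → Carrier) → j < n → ∑< n (λ i → monomial j i * ψ i) ≡ ψ j
  ∑<-monomial zero    (suc n) ψ _ = begin
    1# * ψ 0 + ∑< n (λ i → 0# * ψ (suc i)) ≡⟨ cong₂ _+_ (*-identityˡ _) (trans (∑<-cong n (λ i _ → zeroˡ (ψ (suc i)))) (∑<-0 n)) ⟩
    ψ 0 + 0#                               ≡⟨ +-identityʳ _ ⟩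
    ψ 0                                    ∎
  ∑<-monomial (suc j) (suc n) ψ (s≤s j<n) = begin
    0# * ψ 0 + ∑< n (λ i → monomial j i * ψ (suc i)) ≡⟨ cong₂ _+_ (zeroˡ _) (∑<-monomial j n (ψ ∘ suc) j<n) ⟩
    0# + ψ (suc j)                                    ≡⟨ +-identityˡ _ ⟩
    ψ (suc j)                                         ∎

  ∑<-monomial-out : ∀ j n (ψ : ℕ → Carrier) → n ≤ j → ∑< n (λ i → monomial j i * ψ i) ≡ 0#
  ∑<-monomial-out j n ψ n≤j = trans
    (∑<-cong n (λ i i<n → trans (cong (_* ψ i) (monomial-≢ (λ j≡i → <-irrefl (sym j≡i) (<-≤-trans i<n n≤j)))) (zeroˡ _)))
    (∑<-0 n)

  mulXPow-≤ : ∀ j h {k} → j ≤ k → mulXPow j h k ≡ h (k ∸ j)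
  mulXPow-≤ zero    h _        = refl
  mulXPow-≤ (suc j) h (s≤s le) = mulXPow-≤ j h le

  mulXPow-< : ∀ j h {k} → k < j → mulXPow j h k ≡ 0#
  mulXPow-< (suc j) h {zero}  _         = refl
  mulXPow-< (suc j) h {suc k} (s≤s k<j) = mulXPow-< j h k<j

  mulXPow-degree : ∀ j {d} h → DegreeBelow d h → DegreeBelow (j ℕ.+ d) (mulXPow j h)
  mulXPow-degree zero    h deg = deg
  mulXPow-degree (suc j) h deg (suc k) (s≤s le) = mulXPow-degree j h deg k le

  mulX-cong : ∀ {g h} → (∀ k → g k ≡ h k) → ∀ k → mulX g k ≡ mulX h k
  mulX-cong e zero    = refl
  mulX-cong e (suc k) = e k

  ⋆-distribʳ : ∀ g₁ g₂ h k → ((λ i → g₁ i + g₂ i) ⋆ h) k ≡ (g₁ ⋆ h) k + (g₂ ⋆ h) k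
  ⋆-distribʳ g₁ g₂ h k = trans (∑<-cong (suc k) (λ i _ → distribʳ (h (k ∸ i)) (g₁ i) (g₂ i)))
    (∑<-+ (suc k) (λ i → g₁ i * h (k ∸ i)) (λ i → g₂ i * h (k ∸ i)))

  ⋆-assoc-* : ∀ a g h k → ((λ i → a * g i) ⋆ h) k ≡ a * (g ⋆ h) k
  ⋆-assoc-* a g h k = trans (∑<-cong (suc k) (λ i _ → *-assoc a (g i) (h (k ∸ i))))
    (∑<-distribˡ (suc k) a (λ i → g i * h (k ∸ i)))

  ⋆-zeroˡ : ∀ h k → ((λ _ → 0#) ⋆ h) k ≡ 0#
  ⋆-zeroˡ h k = trans (∑<-cong (suc k) (λ i _ → zeroˡ (h (k ∸ i)))) (∑<-0 (suc k))

  monomial-⋆ : ∀ j h k → (monomial j ⋆ h) k ≡ mulXPow j h k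
  monomial-⋆ j h k with j ≤? k
  ... | yes j≤k = trans (∑<-monomial j (suc k) (λ i → h (k ∸ i)) (s≤s j≤k)) (sym (mulXPow-≤ j h j≤k))
  ... | no  j≰k = trans (∑<-monomial-out j (suc k) (λ i → h (k ∸ i)) (≰⇒> j≰k)) (sym (mulXPow-< j h (≰⇒> j≰k)))

  toPoly-degree : ∀ {n} (v : Vec Carrier n) → DegreeBelow n (toPoly v)
  toPoly-degree []      k       _        = refl
  toPoly-degree (a ∷ v) (suc k) (s≤s le) = toPoly-degree v k le

  toPoly-injective : ∀ {n} (u v : Vec Carrier n) → (∀ k → toPoly u k ≡ toPoly v k) → u ≡ v
  toPoly-injective []      []      e = refl
  toPoly-injective (a ∷ u) (b ∷ v) e = cong₂ _∷_ (e 0) (toPoly-injective u v (e ∘ suc))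

  toPoly-+ᵛ : ∀ {n} (u v : Vec Carrier n) k → toPoly (u +ᵛ v) k ≡ toPoly u k + toPoly v k
  toPoly-+ᵛ []      []      k       = sym (+-identityʳ 0#)
  toPoly-+ᵛ (a ∷ u) (b ∷ v) zero    = refl
  toPoly-+ᵛ (a ∷ u) (b ∷ v) (suc k) = toPoly-+ᵛ u v k

  toPoly-· : ∀ {n} a (u : Vec Carrier n) k → toPoly (a · u) k ≡ a * toPoly u k
  toPoly-· a []      k       = sym (zeroʳ a)
  toPoly-· a (b ∷ u) zero    = refl
  toPoly-· a (b ∷ u) (suc k) = toPoly-· a u k

  toPoly-0ᵛ : ∀ n k → toPoly (0ᵛ {n}) k ≡ 0#
  toPoly-0ᵛ zero    k       = refl
  toPoly-0ᵛ (suc n) zero    = refl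
  toPoly-0ᵛ (suc n) (suc k) = toPoly-0ᵛ n k

  toPoly-shift : ∀ {n} z (v : Vec Carrier n) k →
                 toPoly (shift z v) k + overflow z v * monomial n k ≡ toPoly (z ∷ v) k
  toPoly-shift z []      zero    = trans (+-identityˡ _) (*-identityʳ z)
  toPoly-shift z []      (suc k) = trans (+-identityˡ _) (zeroʳ z)
  toPoly-shift z (a ∷ v) zero    = begin
    toPoly (shift z (a ∷ v)) 0 + overflow z (a ∷ v) * 0#
      ≡⟨ cong₂ (λ x y → toPoly x 0 + y * 0#) (shift-∷ z a v) (overflow-∷ z a v) ⟩
    z + overflow a v * 0#
      ≡⟨ cong (z +_) (zeroʳ _) ⟩
    z + 0#
      ≡⟨ +-identityʳ z ⟩
    z ∎
  toPoly-shift {suc n} z (a ∷ v) (suc k) = begin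
    toPoly (shift z (a ∷ v)) (suc k) + overflow z (a ∷ v) * monomial n k
      ≡⟨ cong₂ (λ x y → toPoly x (suc k) + y * monomial n k) (shift-∷ z a v) (overflow-∷ z a v) ⟩
    toPoly (shift a v) k + overflow a v * monomial n k
      ≡⟨ toPoly-shift a v k ⟩
    toPoly (a ∷ v) k ∎

  toPoly-0∷ : ∀ {n} (v : Vec Carrier n) k → toPoly (0# ∷ v) k ≡ mulX (toPoly v) k
  toPoly-0∷ v zero    = refl
  toPoly-0∷ v (suc k) = refl

module IntegralDomain (F : CommutativeRing≡) {k : ℕ} (c : Vec (CommutativeRing≡.Carrier F) (suc k)) where
  open CommutativeRing≡ F
  open Vectors F
  open QuotientRing F c
  open Polynomials F
  open import Data.Nat.Properties
    using (≤-refl; ≤-trans; n≤1+n; ≤-pred; m≤m+n; m+n∸m≡n; +-suc; m∸n+n≡m; m∸n≤m; m≤n⇒m<n∨m≡n; <-irrefl)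
  open import Data.Vec using (_∷_)
  open import Data.Sum using (inj₁; inj₂)
  open import Data.Product using (∃-syntax)
  open import Data.Empty using (⊥)
  open import Relation.Binary.Definitions using (DecidableEquality)
  open import Relation.Nullary using (yes; no)
  open ≡-Reasoning

  f : Poly
  f i = toPoly c i + monomial (suc k) i

  record NontrivialFactorisation : Set where
    field
      g h           : Poly
      f≡g⋆h         : ∀ i → f i ≡ (g ⋆ h) i
      g-degree      : DegreeBelow (2 ℕ.+ k) g
      h-degree      : DegreeBelow (2 ℕ.+ k) h
      g-nonconstant : ∃[ i ] 1 ≤ i × g i ≡ 1#
      h-nonconstant : ∃[ i ] 1 ≤ i × h i ≡ 1#

  overflow-leading : ∀ (v : V) → overflow 0# v ≡ toPoly v k
  overflow-leading v = begin
    overflow 0# v                                                          ≡⟨ *-identityʳ _ ⟨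
    overflow 0# v * 1#                                                     ≡⟨ +-identityˡ _ ⟨
    0# + overflow 0# v * 1#
      ≡⟨ cong₂ (λ x y → x + overflow 0# v * y) (toPoly-degree (shift 0# v) (suc k) ≤-refl) (monomial-≡ (suc k)) ⟨
    toPoly (shift 0# v) (suc k) + overflow 0# v * monomial (suc k) (suc k) ≡⟨ toPoly-shift 0# v (suc k) ⟩
    toPoly v k                                                             ∎

  toPoly-xMul : ∀ v i → toPoly (xMul v) i ≡ mulX (toPoly v) i + (- overflow 0# v) * f i
  toPoly-xMul v i = begin
    toPoly (shift 0# v +ᵛ (- t) · c) i                                 ≡⟨ toPoly-+ᵛ (shift 0# v) ((- t) · c) i ⟩
    toPoly (shift 0# v) i + toPoly ((- t) · c) i                       ≡⟨ cong₂ _+_ toPoly-shift0 (toPoly-· (- t) c i) ⟩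
    mulX (toPoly v) i + (- t) * monomial (suc k) i + (- t) * toPoly c i ≡⟨ +-assoc _ _ _ ⟩
    mulX (toPoly v) i + ((- t) * monomial (suc k) i + (- t) * toPoly c i) ≡⟨ cong (mulX (toPoly v) i +_) (distribˡ (- t) _ _) ⟨
    mulX (toPoly v) i + (- t) * (monomial (suc k) i + toPoly c i)     ≡⟨ cong (λ z → mulX (toPoly v) i + (- t) * z) (+-comm _ _) ⟩
    mulX (toPoly v) i + (- t) * f i                                    ∎
    where
      t = overflow 0# v
      toPoly-shift0 : toPoly (shift 0# v) i ≡ mulX (toPoly v) i + (- t) * monomial (suc k) i
      toPoly-shift0 = begin
        toPoly (shift 0# v) i                                ≡⟨ x≈z//y _ _ _ (toPoly-shift 0# v i) ⟩
        toPoly (0# ∷ v) i + - (t * monomial (suc k) i)       ≡⟨ cong₂ _+_ (toPoly-0∷ v i) (-‿distribˡ-* t _) ⟩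
        mulX (toPoly v) i + (- t) * monomial (suc k) i       ∎

  module _ (_≟_ : DecidableEquality Carrier)
           (inverse : ∀ x → x ≢ 0# → ∃[ y ] y * x ≡ 1#)
           (irreducible : ¬ NontrivialFactorisation) where

    module Annihilator (r : V) where
      Ann : V → Set
      Ann u = u ⊛ r ≡ 0ᵛ

      Ann-+ᵛ : ∀ {u v} → Ann u → Ann v → Ann (u +ᵛ v)
      Ann-+ᵛ {u} {v} u∈ v∈ = trans (⊛-distribʳ r u v) (trans (cong₂ _+ᵛ_ u∈ v∈) (+ᵛ-identityʳ _))

      Ann-· : ∀ a {u} → Ann u → Ann (a · u)
      Ann-· a {u} u∈ = trans (⊛-·ˡ r a u) (trans (cong (a ·_) u∈) (·-zeroʳ a))

      xMulPow : ℕ → V → V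
      xMulPow zero    v = v
      xMulPow (suc j) v = xMul (xMulPow j v)

      Ann-xMulPow : ∀ j {u} → Ann u → Ann (xMulPow j u)
      Ann-xMulPow zero    u∈ = u∈
      Ann-xMulPow (suc j) {u} u∈ = trans (⊛-xMulˡ r (xMulPow j u)) (trans (cong xMul (Ann-xMulPow j u∈)) xMul-0ᵛ)

      module MinimalMonic (d : ℕ) (d<s : suc d ≤ suc k)
                          (minimal : ∀ u → Ann u → DegreeBelow d (toPoly u) → u ≡ 0ᵛ)
                          (m : V) (m∈Ann : Ann m) (m-degree : DegreeBelow (suc d) (toPoly m)) (m-monic : toPoly m d ≡ 1#) where

        xMulPow-unreduced : ∀ j → j ℕ.+ suc d ≤ suc k → ∀ i → toPoly (xMulPow j m) i ≡ mulXPow j (toPoly m) i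
        xMulPow-unreduced zero    _  i = refl
        xMulPow-unreduced (suc j) le i = begin
          toPoly (xMul (xMulPow j m)) i
            ≡⟨ toPoly-xMul (xMulPow j m) i ⟩
          mulX (toPoly (xMulPow j m)) i + (- top) * f i
            ≡⟨ cong (λ z → mulX (toPoly (xMulPow j m)) i + (- z) * f i) top≡0 ⟩
          mulX (toPoly (xMulPow j m)) i + (- 0#) * f i
            ≡⟨ cong (mulX (toPoly (xMulPow j m)) i +_) (trans (cong (_* f i) -0#≈0#) (zeroˡ (f i))) ⟩
          mulX (toPoly (xMulPow j m)) i + 0#
            ≡⟨ +-identityʳ _ ⟩
          mulX (toPoly (xMulPow j m)) i
            ≡⟨ mulX-cong (xMulPow-unreduced j le′) i ⟩
          mulXPow (suc j) (toPoly m) i ∎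
          where
            le′ = ≤-trans (n≤1+n _) le
            top = overflow 0# (xMulPow j m)
            top≡0 : top ≡ 0#
            top≡0 = trans (overflow-leading (xMulPow j m))
                      (trans (xMulPow-unreduced j le′ k) (mulXPow-degree j (toPoly m) m-degree k (≤-pred le)))

        xMulPow-degree : ∀ j → j ℕ.+ suc d ≤ suc k → DegreeBelow (j ℕ.+ suc d) (toPoly (xMulPow j m))
        xMulPow-degree j le i i≥ = trans (xMulPow-unreduced j le i) (mulXPow-degree j (toPoly m) m-degree i i≥)

        xMulPow-monic : ∀ j → j ℕ.+ suc d ≤ suc k → toPoly (xMulPow j m) (j ℕ.+ d) ≡ 1#
        xMulPow-monic j le = begin
          toPoly (xMulPow j m) (j ℕ.+ d)   ≡⟨ xMulPow-unreduced j le (j ℕ.+ d) ⟩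
          mulXPow j (toPoly m) (j ℕ.+ d)   ≡⟨ mulXPow-≤ j (toPoly m) (m≤m+n j d) ⟩
          toPoly m (j ℕ.+ d ∸ j)           ≡⟨ cong (toPoly m) (m+n∸m≡n j d) ⟩
          toPoly m d                       ≡⟨ m-monic ⟩
          1#                               ∎

        cancel-leading : ∀ j → j ℕ.+ suc d ≤ suc k → ∀ w → DegreeBelow (suc j ℕ.+ d) (toPoly w) →
                         DegreeBelow (j ℕ.+ d) (toPoly (w +ᵛ (- toPoly w (j ℕ.+ d)) · xMulPow j m))
        cancel-leading j le w w-degree i i≥ =
          trans (toPoly-+ᵛ w ((- a) · xʲm) i) (trans (cong (toPoly w i +_) (toPoly-· (- a) xʲm i)) (cancel i i≥))
          where
            a = toPoly w (j ℕ.+ d)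
            xʲm = xMulPow j m
            cancel : ∀ i → j ℕ.+ d ≤ i → toPoly w i + (- a) * toPoly xʲm i ≡ 0#
            cancel i i≥ with m≤n⇒m<n∨m≡n i≥
            ... | inj₂ refl = begin
              a + (- a) * toPoly xʲm (j ℕ.+ d) ≡⟨ cong (λ z → a + (- a) * z) (xMulPow-monic j le) ⟩
              a + (- a) * 1#                   ≡⟨ cong (a +_) (*-identityʳ (- a)) ⟩
              a + - a                          ≡⟨ -‿inverseʳ a ⟩
              0#                               ∎
            ... | inj₁ i> = begin
              toPoly w i + (- a) * toPoly xʲm i
                ≡⟨ cong₂ (λ x y → x + (- a) * y) (w-degree i i>) (xMulPow-degree j le i (subst (_≤ i) (sym (+-suc j d)) i>)) ⟩
              0# + (- a) * 0#                  ≡⟨ +-identityˡ _ ⟩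
              (- a) * 0#                       ≡⟨ zeroʳ (- a) ⟩
              0#                               ∎

        divide : ∀ j → j ℕ.+ d ≤ suc k → ∀ w → Ann w → DegreeBelow (j ℕ.+ d) (toPoly w) →
                 ∃[ h ] DegreeBelow j h × (∀ i → toPoly w i ≡ (h ⋆ toPoly m) i)
        divide zero    _  w w∈ w-degree = (λ _ → 0#) , (λ _ _ → refl) , λ i → begin
          toPoly w i                   ≡⟨ cong (λ z → toPoly z i) (minimal w w∈ w-degree) ⟩
          toPoly (0ᵛ {suc k}) i        ≡⟨ toPoly-0ᵛ (suc k) i ⟩
          0#                           ≡⟨ ⋆-zeroˡ (toPoly m) i ⟨
          ((λ _ → 0#) ⋆ toPoly m) i    ∎
        divide (suc j) le w w∈ w-degree = h , h-degree , w≡h⋆m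
          where
            le′ : j ℕ.+ suc d ≤ suc k
            le′ = subst (_≤ suc k) (sym (+-suc j d)) le
            a = toPoly w (j ℕ.+ d)
            xʲm = xMulPow j m
            w′ = w +ᵛ (- a) · xʲm
            quotient = divide j (≤-trans (n≤1+n _) le) w′ (Ann-+ᵛ w∈ (Ann-· (- a) (Ann-xMulPow j m∈Ann)))
                                (cancel-leading j le′ w w-degree)
            h′ = proj₁ quotient
            h : Poly
            h i = h′ i + a * monomial j i
            h-degree : DegreeBelow (suc j) h
            h-degree i i≥ = begin
              h′ i + a * monomial j i
                ≡⟨ cong₂ (λ x y → x + a * y) (proj₁ (proj₂ quotient) i (≤-trans (n≤1+n j) i≥)) (monomial-≢ (λ j≡i → <-irrefl j≡i i≥)) ⟩
              0# + a * 0#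
                ≡⟨ +-identityˡ _ ⟩
              a * 0#
                ≡⟨ zeroʳ a ⟩
              0# ∎
            w≡h⋆m : ∀ i → toPoly w i ≡ (h ⋆ toPoly m) i
            w≡h⋆m i = begin
              toPoly w i
                ≡⟨ x≈z//y _ _ _ (sym (trans (toPoly-+ᵛ w ((- a) · xʲm) i) (cong (toPoly w i +_) (toPoly-· (- a) xʲm i)))) ⟩
              toPoly w′ i - (- a) * toPoly xʲm i
                ≡⟨ cong (toPoly w′ i +_) (trans (-‿distribˡ-* (- a) _) (cong (_* toPoly xʲm i) (-‿involutive a))) ⟩
              toPoly w′ i + a * toPoly xʲm i
                ≡⟨ cong₂ (λ x y → x + a * y) (proj₂ (proj₂ quotient) i) (xMulPow-unreduced j le′ i) ⟩
              (h′ ⋆ toPoly m) i + a * mulXPow j (toPoly m) i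
                ≡⟨ cong (λ z → (h′ ⋆ toPoly m) i + a * z) (monomial-⋆ j (toPoly m) i) ⟨
              (h′ ⋆ toPoly m) i + a * (monomial j ⋆ toPoly m) i
                ≡⟨ cong ((h′ ⋆ toPoly m) i +_) (⋆-assoc-* a (monomial j) (toPoly m) i) ⟨
              (h′ ⋆ toPoly m) i + ((λ l → a * monomial j l) ⋆ toPoly m) i
                ≡⟨ ⋆-distribʳ h′ (λ l → a * monomial j l) (toPoly m) i ⟨
              (h ⋆ toPoly m) i ∎

        private
          j₀ = k ∸ d
          j₀+d≡k : j₀ ℕ.+ d ≡ k
          j₀+d≡k = m∸n+n≡m (≤-pred d<s)
          j₀+1+d≡1+k : j₀ ℕ.+ suc d ≡ suc k
          j₀+1+d≡1+k = trans (+-suc j₀ d) (cong suc j₀+d≡k)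

        toPoly-xMul-top : ∀ i → toPoly (xMul (xMulPow j₀ m)) i ≡ mulXPow (suc j₀) (toPoly m) i - f i
        toPoly-xMul-top i = trans (toPoly-xMul (xMulPow j₀ m) i)
          (cong₂ _+_ (mulX-cong (xMulPow-unreduced j₀ le) i) (trans (cong (λ z → (- z) * f i) top≡1) (-1*x≈-x (f i))))
          where
            le = subst (_≤ suc k) (sym j₀+1+d≡1+k) ≤-refl
            top≡1 : overflow 0# (xMulPow j₀ m) ≡ 1#
            top≡1 = trans (overflow-leading (xMulPow j₀ m)) (trans (cong (toPoly (xMulPow j₀ m)) (sym j₀+d≡k)) (xMulPow-monic j₀ le))

        -- Dividing x·(x^(k-d)·m) = x^(k+1-d)·m - f by m exhibits m as a factor of f.
        private
          W = xMul (xMulPow j₀ m)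
          W÷m = divide (suc j₀) (subst (_≤ suc k) (sym (cong suc j₀+d≡k)) ≤-refl) W
            (Ann-xMulPow (suc j₀) m∈Ann) (subst (λ e → DegreeBelow e (toPoly W)) (sym (cong suc j₀+d≡k)) (toPoly-degree W))
          h = proj₁ W÷m

        cofactor : Poly
        cofactor i = monomial (suc j₀) i + - 1# * h i

        cofactor-leading : cofactor (suc j₀) ≡ 1#
        cofactor-leading = begin
          monomial j₀ j₀ + - 1# * h (suc j₀)
            ≡⟨ cong₂ (λ x y → x + - 1# * y) (monomial-≡ j₀) (proj₁ (proj₂ W÷m) (suc j₀) ≤-refl) ⟩
          1# + - 1# * 0#
            ≡⟨ cong (1# +_) (zeroʳ _) ⟩
          1# + 0#
            ≡⟨ +-identityʳ 1# ⟩
          1# ∎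

        cofactor-degree : DegreeBelow (2 ℕ.+ k) cofactor
        cofactor-degree i i≥ = begin
          monomial (suc j₀) i + - 1# * h i
            ≡⟨ cong₂ (λ x y → x + - 1# * y) (monomial-≢ (λ j≡i → <-irrefl j≡i (≤-trans (s≤s sj≤sk) i≥)))
                                            (proj₁ (proj₂ W÷m) i (≤-trans sj≤sk (≤-trans (n≤1+n _) i≥))) ⟩
          0# + - 1# * 0#
            ≡⟨ +-identityˡ _ ⟩
          - 1# * 0#
            ≡⟨ zeroʳ _ ⟩
          0# ∎
          where sj≤sk = s≤s (m∸n≤m k d)

        f≡cofactor⋆m : ∀ i → f i ≡ (cofactor ⋆ toPoly m) i
        f≡cofactor⋆m i = sym (begin
          (cofactor ⋆ toPoly m) i
            ≡⟨ ⋆-distribʳ (monomial (suc j₀)) (λ l → - 1# * h l) (toPoly m) i ⟩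
          (monomial (suc j₀) ⋆ toPoly m) i + ((λ l → - 1# * h l) ⋆ toPoly m) i
            ≡⟨ cong₂ _+_ (monomial-⋆ (suc j₀) (toPoly m) i) (⋆-assoc-* (- 1#) h (toPoly m) i) ⟩
          M + - 1# * (h ⋆ toPoly m) i
            ≡⟨ cong (M +_) (-1*x≈-x _) ⟩
          M - (h ⋆ toPoly m) i
            ≡⟨ cong (λ z → M - z) (proj₂ (proj₂ W÷m) i) ⟨
          M - toPoly W i
            ≡⟨ cong (λ z → M - z) (toPoly-xMul-top i) ⟩
          M - (M - f i)
            ≡⟨ cong (M +_) (⁻¹-anti-homo‿- M (f i)) ⟩
          M + (f i - M)
            ≡⟨ +-assoc M (f i) (- M) ⟨
          M + f i - M
            ≡⟨ xyx⁻¹≈y M (f i) ⟩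
          f i ∎)
          where M = mulXPow (suc j₀) (toPoly m) i

        factorisation : 1 ≤ d → NontrivialFactorisation
        factorisation 1≤d = record
          { g = cofactor ; h = toPoly m ; f≡g⋆h = f≡cofactor⋆m
          ; g-degree = cofactor-degree ; h-degree = λ i i≥ → m-degree i (≤-trans d<s (≤-trans (n≤1+n _) i≥))
          ; g-nonconstant = suc j₀ , s≤s z≤n , cofactor-leading ; h-nonconstant = d , 1≤d , m-monic }

      minimalMonic-absurd : r ≢ 0ᵛ → ∀ d → suc d ≤ suc k → (∀ u → Ann u → DegreeBelow d (toPoly u) → u ≡ 0ᵛ) →
                            ∀ m → Ann m → DegreeBelow (suc d) (toPoly m) → toPoly m d ≡ 1# → ⊥
      minimalMonic-absurd r≢0 zero _ _ m m∈Ann m-degree m-monic = r≢0 (begin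
        r         ≡⟨ ⊛-identityˡ r ⟨
        1ᵛ ⊛ r    ≡⟨ cong (_⊛ r) m≡1ᵛ ⟨
        m ⊛ r     ≡⟨ m∈Ann ⟩
        0ᵛ        ∎)
        where
          m≡1ᵛ : m ≡ 1ᵛ
          m≡1ᵛ = toPoly-injective m 1ᵛ λ where
            zero    → m-monic
            (suc i) → trans (m-degree (suc i) (s≤s z≤n)) (sym (toPoly-0ᵛ k i))
      minimalMonic-absurd r≢0 (suc d) d<s minimal m m∈Ann m-degree m-monic =
        irreducible (MinimalMonic.factorisation (suc d) d<s minimal m m∈Ann m-degree m-monic (s≤s z≤n))

      Ann-degree<⇒0 : r ≢ 0ᵛ → ∀ d → d ≤ suc k → ∀ u → Ann u → DegreeBelow d (toPoly u) → u ≡ 0ᵛ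
      Ann-degree<⇒0 r≢0 zero    _  u _  u-degree = toPoly-injective u 0ᵛ (λ i → trans (u-degree i z≤n) (sym (toPoly-0ᵛ (suc k) i)))
      Ann-degree<⇒0 r≢0 (suc d) le u u∈ u-degree with toPoly u d ≟ 0#
      ... | yes lead≡0 = Ann-degree<⇒0 r≢0 d (≤-trans (n≤1+n d) le) u u∈ u-degree′
        where
          u-degree′ : DegreeBelow d (toPoly u)
          u-degree′ i i≥ with m≤n⇒m<n∨m≡n i≥
          ... | inj₁ i> = u-degree i i>
          ... | inj₂ refl = lead≡0
      ... | no lead≢0 = contradiction m-monic
                          (minimalMonic-absurd r≢0 d le (Ann-degree<⇒0 r≢0 d (≤-trans (n≤1+n d) le)) m (Ann-· ℓ u∈) m-degree)
        where
          ℓ = proj₁ (inverse (toPoly u d) lead≢0)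
          m = ℓ · u
          m-degree : DegreeBelow (suc d) (toPoly m)
          m-degree i i≥ = trans (toPoly-· ℓ u i) (trans (cong (ℓ *_) (u-degree i i≥)) (zeroʳ ℓ))
          m-monic : toPoly m d ≡ 1#
          m-monic = trans (toPoly-· ℓ u d) (proj₂ (inverse (toPoly u d) lead≢0))

    noZeroDivisors : ∀ r u → r ≢ 0ᵛ → u ⊛ r ≡ 0ᵛ → u ≡ 0ᵛ
    noZeroDivisors r u r≢0 u⊛r≡0 = Annihilator.Ann-degree<⇒0 r r≢0 (suc k) ≤-refl u u⊛r≡0 (toPoly-degree u)

module Counting where
  open import Data.Nat using (_+_; _*_)
  open import Data.Nat.Properties using (n≮n; ≤-trans; *-distribʳ-+)
  open import Data.Nat.Divisibility using (_∣?_; _∣0; ∣⇒≤; ∣m+n∣m⇒∣n; ∣m∣n⇒∣m+n; ∣-refl)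
  open import Data.Nat.ListAction using (sum)
  open import Data.Vec using ([]; _∷_)
  import Data.Vec.Properties as Vec
  open import Data.List as List using (List; []; _∷_; _++_; length; filter; concatMap; cartesianProductWith)
  import Data.List.Properties as List
  open import Data.List.Membership.Propositional using (_∈_)
  open import Data.List.Membership.DecPropositional using (_∈?_)
  open import Data.List.Membership.Propositional.Properties using (∈-cartesianProductWith⁺; ∈-allFin)
  open import Data.List.Membership.Propositional.Properties.WithK using (unique∧set⇒bag)
  open import Data.List.Relation.Binary.BagAndSetEquality using (∼bag⇒↭)
  open import Data.List.Relation.Binary.Permutation.Propositional.Properties using (filter-↭; ↭-length)
  open import Data.List.Relation.Unary.All as All using (All; []; _∷_)
  open import Data.List.Relation.Unary.All.Properties using (applyUpTo⁺₁)
  open import Data.List.Relation.Unary.AllPairs using ([]; _∷_)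
  open import Data.List.Relation.Unary.Any using (here; there)
  open import Data.List.Relation.Unary.Unique.Propositional using (Unique)
  import Data.List.Relation.Unary.Unique.Propositional.Properties as Unique
  open import Function using (_∘_)
  open import Function.Definitions using (Injective)
  open import Relation.Binary.Definitions using (DecidableEquality)
  open import Relation.Nullary using (yes; no)
  open import Relation.Unary using (Decidable)
  open ≡-Reasoning

  private variable A B C : Set

  count : {P : A → Set} → Decidable P → List A → ℕ
  count P? = length ∘ filter P?

  module _ {P : A → Set} (P? : Decidable P) where

    count-none : ∀ {xs} → All (¬_ ∘ P) xs → count P? xs ≡ 0
    count-none         []           = refl
    count-none {x ∷ _} (¬Px ∷ ¬Pxs) with P? x
    ... | yes Px = contradiction Px ¬Px
    ... | no  _  = count-none ¬Pxs

    count-++ : ∀ xs ys → count P? (xs ++ ys) ≡ count P? xs + count P? ys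
    count-++ xs ys = trans (cong length (List.filter-++ P? xs ys)) (List.length-++ (filter P? xs))

    count-map : ∀ (f : B → A) xs → count P? (List.map f xs) ≡ count (P? ∘ f) xs
    count-map f []       = refl
    count-map f (x ∷ xs) with P? (f x)
    ... | yes _ = cong suc (count-map f xs)
    ... | no  _ = count-map f xs

    count-cartesianProductWith : ∀ (f : B → C → A) xs ys →
      count P? (cartesianProductWith f xs ys) ≡ sum (List.map (λ x → count (P? ∘ f x) ys) xs)
    count-cartesianProductWith f []       ys = refl
    count-cartesianProductWith f (x ∷ xs) ys =
      trans (count-++ (List.map (f x) ys) _) (cong₂ _+_ (count-map (f x) ys) (count-cartesianProductWith f xs ys))

    sum-count-weighted : ∀ (g : A → ℕ) K → (∀ x → g x ≡ count P? (x ∷ []) * K) →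
                         ∀ xs → sum (List.map g xs) ≡ count P? xs * K
    sum-count-weighted g K g≡ []       = refl
    sum-count-weighted g K g≡ (x ∷ xs) = begin
      g x + sum (List.map g xs)                         ≡⟨ cong₂ _+_ (g≡ x) (sum-count-weighted g K g≡ xs) ⟩
      count P? (x ∷ []) * K + count P? xs * K           ≡⟨ *-distribʳ-+ K (count P? (x ∷ [])) (count P? xs) ⟨
      (count P? (x ∷ []) + count P? xs) * K             ≡⟨ cong (_* K) (count-++ (x ∷ []) xs) ⟨
      count P? (x ∷ xs) * K                             ∎

    sum-count : ∀ (g : A → ℕ) → (∀ x → g x ≡ count P? (x ∷ [])) → ∀ xs → sum (List.map g xs) ≡ count P? xs
    sum-count g g≡ []       = refl
    sum-count g g≡ (x ∷ xs) = trans (cong₂ _+_ (g≡ x) (sum-count g g≡ xs)) (sym (count-++ (x ∷ []) xs))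

  count-cong : ∀ {P Q : A → Set} (P? : Decidable P) (Q? : Decidable Q) → (∀ x → P x ⇔ Q x) → ∀ xs → count P? xs ≡ count Q? xs
  count-cong P? Q? P⇔Q []       = refl
  count-cong P? Q? P⇔Q (x ∷ xs) with P? x | Q? x
  ... | yes _  | yes _  = cong suc (count-cong P? Q? P⇔Q xs)
  ... | yes Px | no ¬Qx = contradiction (Equivalence.to (P⇔Q x) Px) ¬Qx
  ... | no ¬Px | yes Qx = contradiction (Equivalence.from (P⇔Q x) Qx) ¬Px
  ... | no _   | no _   = count-cong P? Q? P⇔Q xs

  count-singleton-cong : ∀ {P : A → Set} {Q : B → Set} (P? : Decidable P) (Q? : Decidable Q) {x y} →
                         P x ⇔ Q y → count P? (x ∷ []) ≡ count Q? (y ∷ [])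
  count-singleton-cong P? Q? {x} {y} Px⇔Qy with P? x | Q? y
  ... | yes _  | yes _  = refl
  ... | yes Px | no ¬Qy = contradiction (Equivalence.to Px⇔Qy Px) ¬Qy
  ... | no ¬Px | yes Qy = contradiction (Equivalence.from Px⇔Qy Qy) ¬Px
  ... | no _   | no _   = refl

  count-only : ∀ {P : A → Set} (P? : Decidable P) (w : A) {ys} → Unique ys → w ∈ ys →
               (∀ z → P z → z ≡ w) → count P? ys ≡ count P? (w ∷ [])
  count-only P? w {ys} uniq w∈ys only-w with P? w
  ... | no ¬Pw = count-none P? (All.universal (λ z Pz → ¬Pw (subst _ (only-w z Pz) Pz)) ys)
  ... | yes Pw = go uniq w∈ys
    where
      go : ∀ {ys} → Unique ys → w ∈ ys → count P? ys ≡ 1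
      go {y ∷ ys} (y∉ys ∷ uniq) w∈ with P? y
      ... | yes Py = cong suc (count-none P? (All.map (λ {z} y≢z Pz → y≢z (trans (only-w y Py) (sym (only-w z Pz)))) y∉ys))
      ... | no ¬Py with w∈
      ...   | here refl = contradiction Pw ¬Py
      ...   | there w∈ys = go uniq w∈ys

  module _ {A : Set} (_≟_ : DecidableEquality A) where

    remove : A → List A → List A
    remove a []      = []
    remove a (x ∷ l) with x ≟ a
    ... | yes _ = l
    ... | no  _ = x ∷ remove a l

    length-remove : ∀ {a l} → a ∈ l → suc (length (remove a l)) ≡ length l
    length-remove {a} {x ∷ l} a∈ with x ≟ a | a∈
    ... | yes _   | _          = refl
    ... | no  x≢a | here a≡x   = contradiction (sym a≡x) x≢a
    ... | no  _   | there a∈l  = cong suc (length-remove a∈l)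

    ∈-remove : ∀ {a y l} → y ∈ l → y ≢ a → y ∈ remove a l
    ∈-remove {a} {y} {x ∷ l} y∈ y≢a with x ≟ a | y∈
    ... | yes refl | here refl  = contradiction refl y≢a
    ... | yes _    | there y∈l  = y∈l
    ... | no  _    | here y≡x   = here y≡x
    ... | no  _    | there y∈l  = there (∈-remove y∈l y≢a)

    unique-⊆⇒length≤ : ∀ {ys zs} → Unique ys → (∀ {y} → y ∈ ys → y ∈ zs) → length ys ≤ length zs
    unique-⊆⇒length≤ {[]}     _            _    = z≤n
    unique-⊆⇒length≤ {y ∷ ys} (y∉ys ∷ uniq) ys⊆zs = subst (suc (length ys) ≤_) (length-remove (ys⊆zs (here refl)))
      (s≤s (unique-⊆⇒length≤ uniq (λ z∈ys → ∈-remove (ys⊆zs (there z∈ys)) (λ z≡y → All.lookup y∉ys z∈ys (sym z≡y)))))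

    module _ {xs : List A} (unique : Unique xs) (complete : ∀ a → a ∈ xs) where

      injective⇒∈-map : (σ : A → A) → Injective _≡_ _≡_ σ → ∀ a → a ∈ List.map σ xs
      injective⇒∈-map σ σ-inj a with _∈?_ _≟_ a (List.map σ xs)
      ... | yes a∈ = a∈
      ... | no  a∉ = contradiction
        (subst (_≤ length (remove a xs)) (trans (List.length-map σ xs) (sym (length-remove (complete a))))
          (unique-⊆⇒length≤ (Unique.map⁺ σ-inj unique)
            (λ {y} y∈ → ∈-remove (complete y) (λ y≡a → a∉ (subst (_∈ List.map σ xs) y≡a y∈)))))
        (n≮n _)

      count-∘-injective : ∀ {P : A → Set} (P? : Decidable P) (σ : A → A) → Injective _≡_ _≡_ σ →
                          count (P? ∘ σ) xs ≡ count P? xs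
      count-∘-injective P? σ σ-inj = trans (sym (count-map P? σ xs))
        (↭-length (filter-↭ P? (∼bag⇒↭ (unique∧set⇒bag (Unique.map⁺ σ-inj unique) unique
          (λ {x} → mk⇔ (λ _ → complete x) (λ _ → injective⇒∈-map σ σ-inj x))))))

  allFin-toℕ : ∀ n → List.map toℕ (List.allFin n) ≡ List.upTo n
  allFin-toℕ n = trans (List.map-tabulate (λ i → i) toℕ) (go n (λ i → i))
    where
      go : ∀ {A : Set} n (h : ℕ → A) → List.tabulate {n = n} (h ∘ toℕ) ≡ List.applyUpTo h n
      go zero    h = refl
      go (suc n) h = cong (h 0 ∷_) (go n (h ∘ suc))

  applyUpTo-+ : ∀ (f : ℕ → A) m n → List.applyUpTo f (m + n) ≡ List.applyUpTo f m ++ List.applyUpTo (f ∘ (m +_)) n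
  applyUpTo-+ f zero    n = refl
  applyUpTo-+ f (suc m) n = cong (f 0 ∷_) (applyUpTo-+ (f ∘ suc) m n)

  count-∣-upTo-d : ∀ d .{{_ : NonZero d}} → count (d ∣?_) (List.upTo d) ≡ 1
  count-∣-upTo-d (suc d) with suc d ∣? 0
  ... | yes _  = cong suc (count-none (suc d ∣?_)
                   (applyUpTo⁺₁ suc d (λ {i} i<d d∣i → n≮n _ (≤-trans (s≤s i<d) (∣⇒≤ d∣i)))))
  ... | no ¬d∣0 = contradiction (suc d ∣0) ¬d∣0

  count-∣-upTo : ∀ d .{{_ : NonZero d}} m → count (d ∣?_) (List.upTo (m * d)) ≡ m
  count-∣-upTo d zero    = refl
  count-∣-upTo d (suc m) = begin
    count (d ∣?_) (List.upTo (d + m * d))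
      ≡⟨ cong (count (d ∣?_)) (applyUpTo-+ (λ i → i) d (m * d)) ⟩
    count (d ∣?_) (List.upTo d ++ List.applyUpTo (d +_) (m * d))
      ≡⟨ count-++ (d ∣?_) (List.upTo d) _ ⟩
    count (d ∣?_) (List.upTo d) + count (d ∣?_) (List.applyUpTo (d +_) (m * d))
      ≡⟨ cong₂ _+_ (count-∣-upTo-d d) shifted ⟩
    suc m ∎
    where
      open ≡-Reasoning
      shifted : count (d ∣?_) (List.applyUpTo (d +_) (m * d)) ≡ m
      shifted = begin
        count (d ∣?_) (List.applyUpTo (d +_) (m * d))
          ≡⟨ cong (count (d ∣?_)) (List.map-upTo (d +_) (m * d)) ⟨
        count (d ∣?_) (List.map (d +_) (List.upTo (m * d)))
          ≡⟨ count-map (d ∣?_) (d +_) (List.upTo (m * d)) ⟩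
        count ((d ∣?_) ∘ (d +_)) (List.upTo (m * d))
          ≡⟨ count-cong ((d ∣?_) ∘ (d +_)) (d ∣?_)
               (λ i → mk⇔ (λ d∣d+i → ∣m+n∣m⇒∣n d∣d+i ∣-refl) (∣m∣n⇒∣m+n ∣-refl)) (List.upTo (m * d)) ⟩
        count (d ∣?_) (List.upTo (m * d))
          ≡⟨ count-∣-upTo d m ⟩
        m ∎

  allVec-suc : ∀ q n → allVec q (suc n) ≡ cartesianProductWith _∷_ (List.allFin q) (allVec q n)
  allVec-suc q n = go (List.allFin q)
    where
      go : ∀ xs → concatMap (λ x → List.map (x ∷_) (allVec q n)) xs ≡ cartesianProductWith _∷_ xs (allVec q n)
      go []       = refl
      go (x ∷ xs) = cong (List.map (x ∷_) (allVec q n) ++_) (go xs)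

  allVec-unique : ∀ q n → Unique (allVec q n)
  allVec-unique q zero    = [] ∷ []
  allVec-unique q (suc n) = subst Unique (sym (allVec-suc q n))
    (Unique.cartesianProductWith⁺ _∷_ Vec.∷-injective (Unique.allFin⁺ q) (allVec-unique q n))

  ∈-allVec : ∀ {q n} (v : Vec (Fin q) n) → v ∈ allVec q n
  ∈-allVec {q} {zero}  []      = here refl
  ∈-allVec {q} {suc n} (x ∷ v) = subst (x ∷ v ∈_) (sym (allVec-suc q n))
    (∈-cartesianProductWith⁺ _∷_ (∈-allFin x) (∈-allVec v))

module PrimeField (p : ℕ) (pp : Prime p) where
  open import Data.Nat using (_+_; _*_; nonTrivial⇒n>1)
  open import Data.Nat.Properties
  open import Data.Nat.DivMod
  open import Data.Nat.Divisibility using (n∣m*n; n∣n)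
  open import Data.Nat.Coprimality using (prime⇒coprime; coprime-Bézout)
  open import Data.Nat.GCD using (module Bézout)
  open import Data.Fin.Properties using (toℕ-injective; toℕ<n)
  open import Data.Product using (∃-syntax)
  open import Data.Sum using (inj₁; inj₂)
  open import Data.List using ([]; _∷_)

  instance
    p≢0 : NonZero p
    p≢0 = prime⇒nonZero pp

  open ZMod p public
  open ≡-Reasoning

  1<p : 1 < p
  1<p = nonTrivial⇒n>1 p {{prime⇒nonTrivial pp}}

  toℕ-1q : toℕ 1q ≡ 1
  toℕ-1q = trans (toℕ-mod 1) (m<n⇒m%n≡m 1<p)

  1q≢0q : 1q ≢ 0q
  1q≢0q 1≡0 with () ← trans (sym toℕ-1q) (trans (cong toℕ 1≡0) toℕ-0q)

  odd⇒1+1≢0 : p % 2 ≡ 1 → 1q +q 1q ≢ 0q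
  odd⇒1+1≢0 p-odd 2≡0 = contradiction (trans (sym (m<n⇒m%n≡m 2<p)) (trans (sym to2) (trans (cong toℕ 2≡0) toℕ-0q))) λ ()
    where
      2<p : 2 < p
      2<p with m≤n⇒m<n∨m≡n 1<p
      ... | inj₁ 2<p  = 2<p
      ... | inj₂ 2≡p  = contradiction (trans (cong (_% 2) 2≡p) p-odd) λ ()
      to2 : toℕ (1q +q 1q) ≡ 2 % p
      to2 = trans (toℕ-+q 1q 1q) (cong (λ n → (n + n) % p) toℕ-1q)

  1-isUnit : PolyModP.IsUnitₚ p (1 ∷ [])
  1-isUnit = (λ 1%p≡0 → 1q≢0q (toℕ-injective (trans (toℕ-mod 1) (trans 1%p≡0 (sym toℕ-0q))))) , λ _ → 0%n≡0

  *q-inverse : ∀ (x : Fin p) → x ≢ 0q → ∃[ y ] y *q x ≡ 1q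
  *q-inverse x x≢0 with coprime-Bézout (prime⇒coprime pp {{x≢0⇒nonZero}} (toℕ<n x))
    where
      x≢0⇒nonZero : NonZero (toℕ x)
      x≢0⇒nonZero with toℕ x in eq
      ... | zero  = contradiction (toℕ-injective (trans eq (sym toℕ-0q))) x≢0
      ... | suc _ = _
  ... | Bézout.-+ a y eq = y mod p , mod-cong (begin
    (toℕ (y mod p) * toℕ x) % p ≡⟨ cong (λ z → (z * toℕ x) % p) (toℕ-mod y) ⟩
    (y % p * toℕ x) % p         ≡⟨ %-absorbˡ-* y (toℕ x) ⟩
    (y * toℕ x) % p             ≡⟨ cong (_% p) eq ⟨
    (1 + a * p) % p             ≡⟨ %-remove-+ʳ 1 {a * p} {p} (n∣m*n a) ⟩
    1 % p                       ∎)
  -- here 1 + y·x = a·p, so (p - 1)·y ≡ -y is the inverse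
  ... | Bézout.+- a y eq = ((p ∸ 1) * y) mod p , mod-cong (begin
    (toℕ (((p ∸ 1) * y) mod p) * toℕ x) % p ≡⟨ cong (λ z → (z * toℕ x) % p) (toℕ-mod _) ⟩
    ((p ∸ 1) * y % p * toℕ x) % p           ≡⟨ %-absorbˡ-* ((p ∸ 1) * y) (toℕ x) ⟩
    ((p ∸ 1) * y * toℕ x) % p               ≡⟨ %-remove-+ʳ _ (n∣n {p}) ⟨
    ((p ∸ 1) * y * toℕ x + p) % p           ≡⟨ cong (_% p) key ⟩
    ((p ∸ 1) * a * p + 1) % p               ≡⟨ %-remove-+ˡ 1 (n∣m*n ((p ∸ 1) * a)) ⟩
    1 % p                                   ∎)
    where
      key : (p ∸ 1) * y * toℕ x + p ≡ (p ∸ 1) * a * p + 1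
      key = begin
        (p ∸ 1) * y * toℕ x + p                 ≡⟨ cong ((p ∸ 1) * y * toℕ x +_) (m∸n+n≡m (<⇒≤ 1<p)) ⟨
        (p ∸ 1) * y * toℕ x + (p ∸ 1 + 1)       ≡⟨ +-assoc _ (p ∸ 1) 1 ⟨
        (p ∸ 1) * y * toℕ x + (p ∸ 1) + 1       ≡⟨ cong (_+ 1) (begin
          (p ∸ 1) * y * toℕ x + (p ∸ 1)         ≡⟨ cong₂ _+_ (*-assoc (p ∸ 1) y (toℕ x)) (sym (*-identityʳ (p ∸ 1))) ⟩
          (p ∸ 1) * (y * toℕ x) + (p ∸ 1) * 1   ≡⟨ *-distribˡ-+ (p ∸ 1) _ 1 ⟨
          (p ∸ 1) * (y * toℕ x + 1)             ≡⟨ cong ((p ∸ 1) *_) (trans (+-comm _ 1) eq) ⟩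
          (p ∸ 1) * (a * p)                     ≡⟨ *-assoc (p ∸ 1) a p ⟨
          (p ∸ 1) * a * p                       ∎) ⟩
        (p ∸ 1) * a * p + 1                     ∎

module Reduction (p : ℕ) (pp : Prime p) (t : ℕ) (1≤t : 1 ≤ t) where
  open import Data.Nat using (_+_; _*_)
  open import Data.Nat.Properties hiding (_≟_)
  open import Data.Nat.DivMod
  open import Data.Nat.Divisibility
  open import Data.Fin using (_≟_)
  open import Data.Fin.Properties using (toℕ-injective; toℕ<n)
  open import Data.Vec using ([]; _∷_; map; replicate; head; tail)
  import Data.Vec.Properties
  open import Data.Vec.Relation.Unary.All as All using (All; []; _∷_)
  import Data.Vec.Relation.Unary.All.Properties as All
  open import Function using (_∘_)
  open import Relation.Binary.Definitions using (DecidableEquality)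

  module 𝔽ₚ = PrimeField p pp
  open 𝔽ₚ using (p≢0)

  q : ℕ
  q = p ^ t

  instance
    q≢0 : NonZero q
    q≢0 = m^n≢0 p t

  module ℤq = ZMod q
  module 𝔽 = CommutativeRing≡ 𝔽ₚ.ring
  module ℤ = CommutativeRing≡ ℤq.ring
  open ≡-Reasoning

  p^-mono-∣ : ∀ {i j} → i ≤ j → p ^ i ∣ p ^ j
  p^-mono-∣ {i} {j} i≤j = divides (p ^ (j ∸ i)) (trans (cong (p ^_) (sym (m∸n+n≡m i≤j))) (^-distribˡ-+-* p (j ∸ i) i))

  p∣q : p ∣ q
  p∣q = subst (_∣ q) (*-identityʳ p) (p^-mono-∣ 1≤t)

  π : Fin q → Fin p
  π a = toℕ a mod p

  toℕ-π : ∀ a → toℕ (π a) ≡ toℕ a % p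
  toℕ-π a = 𝔽ₚ.toℕ-mod (toℕ a)

  π-+ : ∀ x y → π (x ℤ.+ y) ≡ π x 𝔽.+ π y
  π-+ x y = toℕ-injective (begin
    toℕ (π (x ℤ.+ y))                 ≡⟨ toℕ-π _ ⟩
    toℕ (x ℤ.+ y) % p                 ≡⟨ cong (_% p) (ℤq.toℕ-+q x y) ⟩
    (toℕ x + toℕ y) % q % p           ≡⟨ m∣n⇒o%n%m≡o%m p q _ p∣q ⟩
    (toℕ x + toℕ y) % p               ≡⟨ %-distribˡ-+ (toℕ x) (toℕ y) p ⟩
    (toℕ x % p + toℕ y % p) % p       ≡⟨ cong₂ (λ u v → (u + v) % p) (toℕ-π x) (toℕ-π y) ⟨
    (toℕ (π x) + toℕ (π y)) % p       ≡⟨ 𝔽ₚ.toℕ-+q (π x) (π y) ⟨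
    toℕ (π x 𝔽.+ π y)                 ∎)

  π-* : ∀ x y → π (x ℤ.* y) ≡ π x 𝔽.* π y
  π-* x y = toℕ-injective (begin
    toℕ (π (x ℤ.* y))                 ≡⟨ toℕ-π _ ⟩
    toℕ (x ℤ.* y) % p                 ≡⟨ cong (_% p) (ℤq.toℕ-*q x y) ⟩
    (toℕ x * toℕ y) % q % p           ≡⟨ m∣n⇒o%n%m≡o%m p q _ p∣q ⟩
    (toℕ x * toℕ y) % p               ≡⟨ %-distribˡ-* (toℕ x) (toℕ y) p ⟩
    (toℕ x % p * (toℕ y % p)) % p     ≡⟨ cong₂ (λ u v → (u * v) % p) (toℕ-π x) (toℕ-π y) ⟨
    (toℕ (π x) * toℕ (π y)) % p       ≡⟨ 𝔽ₚ.toℕ-*q (π x) (π y) ⟨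
    toℕ (π x 𝔽.* π y)                 ∎)

  π-0 : π ℤ.0# ≡ 𝔽.0#
  π-0 = toℕ-injective (trans (toℕ-π _) (trans (cong (_% p) ℤq.toℕ-0q) (trans 𝔽ₚ.0%n≡0 (sym 𝔽ₚ.toℕ-0q))))

  π-1 : π ℤ.1# ≡ 𝔽.1#
  π-1 = toℕ-injective (trans (toℕ-π _) (trans (cong (_% p) (ℤq.toℕ-mod 1)) (trans (m∣n⇒o%n%m≡o%m p q 1 p∣q) (sym (𝔽ₚ.toℕ-mod 1)))))

  open RingHomomorphism ℤq.ring 𝔽ₚ.ring π π-+ π-* π-0 public

  π≡0⇔p∣ : ∀ a → π a ≡ 𝔽.0# ⇔ p ∣ toℕ a
  π≡0⇔p∣ a = mk⇔
    (λ e → m%n≡0⇒n∣m (toℕ a) p (trans (sym (toℕ-π a)) (trans (cong toℕ e) 𝔽ₚ.toℕ-0q)))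
    (λ d → toℕ-injective (trans (toℕ-π a) (trans (n∣m⇒m%n≡0 (toℕ a) p d) (sym 𝔽ₚ.toℕ-0q))))

  ι : ℕ → Fin q
  ι n = n mod q

  open Vectors ℤq.ring using (_·_)

  toℕ-ι* : ∀ n z → toℕ (ι n ℤ.* z) ≡ (n * toℕ z) % q
  toℕ-ι* n z = trans (ℤq.toℕ-*q (ι n) z) (trans (cong (λ u → (u * toℕ z) % q) (ℤq.toℕ-mod n)) (ℤq.%-absorbˡ-* n (toℕ z)))

  q∣⇒≡0 : ∀ a → q ∣ toℕ a → a ≡ ℤ.0#
  q∣⇒≡0 a q∣a = toℕ-injective (trans (go (toℕ<n a) q∣a) (sym ℤq.toℕ-0q))
    where
      go : ∀ {m} → m < q → q ∣ m → m ≡ 0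
      go {zero}  _   _   = refl
      go {suc m} m<q q∣m = contradiction (∣⇒≤ q∣m) (<⇒≱ m<q)

  quotientBy : ℕ → Fin q → Fin q
  quotientBy d a = (toℕ a / p ^ d) mod q
    where instance _ = m^n≢0 p d

  p^∣⇒≡ι* : ∀ d a → p ^ d ∣ toℕ a → a ≡ ι (p ^ d) ℤ.* quotientBy d a
  p^∣⇒≡ι* d a p^d∣a = toℕ-injective (sym (begin
    toℕ (ι (p ^ d) ℤ.* quotientBy d a)   ≡⟨ toℕ-ι* (p ^ d) (quotientBy d a) ⟩
    (p ^ d * toℕ (quotientBy d a)) % q   ≡⟨ cong (λ u → (p ^ d * u) % q) (ℤq.toℕ-mod _) ⟩
    (p ^ d * ((toℕ a / p ^ d) % q)) % q  ≡⟨ ℤq.%-absorbʳ-* (p ^ d) _ ⟩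
    (p ^ d * (toℕ a / p ^ d)) % q        ≡⟨ cong (_% q) (m*[n/m]≡n p^d∣a) ⟩
    toℕ a % q                            ≡⟨ ℤq.toℕ%n a ⟩
    toℕ a                                ∎))
    where instance _ = m^n≢0 p d

  p^∣ι* : ∀ {d} → d ≤ t → ∀ a → p ^ d ∣ toℕ (ι (p ^ d) ℤ.* a)
  p^∣ι* {d} d≤t a = subst (p ^ d ∣_) (sym (toℕ-ι* (p ^ d) a)) (%-presˡ-∣ (m∣m*n (toℕ a)) (p^-mono-∣ d≤t))

  p^1+d∣ι*⇔p∣ : ∀ {d} → suc d ≤ t → ∀ a → p ^ suc d ∣ toℕ (ι (p ^ d) ℤ.* a) ⇔ p ∣ toℕ a
  p^1+d∣ι*⇔p∣ {d} d<t a = mk⇔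
    (λ p^1+d∣ → *-cancelˡ-∣ (p ^ d) (subst (_∣ p ^ d * toℕ a) (*-comm p (p ^ d))
                  (∣n∣m%n⇒∣m (p^-mono-∣ d<t) (subst (p ^ suc d ∣_) (toℕ-ι* (p ^ d) a) p^1+d∣))))
    (λ p∣a → subst (p ^ suc d ∣_) (sym (toℕ-ι* (p ^ d) a))
               (%-presˡ-∣ (subst (_∣ p ^ d * toℕ a) (*-comm (p ^ d) p) (*-monoʳ-∣ (p ^ d) p∣a)) (p^-mono-∣ d<t)))
    where instance _ = m^n≢0 p d

  infix 4 _∣ᵛ_

  _∣ᵛ_ : ℕ → ∀ {n} → Vec (Fin q) n → Set
  d ∣ᵛ v = All (λ a → d ∣ toℕ a) v

  ∣ᵛ-weaken : ∀ {d e n} {v : Vec (Fin q) n} → d ∣ e → e ∣ᵛ v → d ∣ᵛ v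
  ∣ᵛ-weaken d∣e = All.map (∣-trans d∣e)

  q∣ᵛ⇒0ᵛ : ∀ {n} (v : Vec (Fin q) n) → q ∣ᵛ v → v ≡ replicate n ℤ.0#
  q∣ᵛ⇒0ᵛ []      []         = refl
  q∣ᵛ⇒0ᵛ (a ∷ v) (q∣a ∷ q∣v) = cong₂ _∷_ (q∣⇒≡0 a q∣a) (q∣ᵛ⇒0ᵛ v q∣v)

  0ᵛ-divisible : ∀ d {n} → d ∣ᵛ replicate n ℤ.0#
  0ᵛ-divisible d {zero}  = []
  0ᵛ-divisible d {suc n} = subst (d ∣_) (sym ℤq.toℕ-0q) (d ∣0) ∷ 0ᵛ-divisible d

  p^∣ᵛ⇒≡ι· : ∀ d {n} (v : Vec (Fin q) n) → p ^ d ∣ᵛ v → v ≡ ι (p ^ d) · map (quotientBy d) v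
  p^∣ᵛ⇒≡ι· d []      []               = refl
  p^∣ᵛ⇒≡ι· d (a ∷ v) (p^d∣a ∷ p^d∣v) = cong₂ _∷_ (p^∣⇒≡ι* d a p^d∣a) (p^∣ᵛ⇒≡ι· d v p^d∣v)

  p^∣ᵛι· : ∀ {d n} → d ≤ t → (z : Vec (Fin q) n) → p ^ d ∣ᵛ ι (p ^ d) · z
  p^∣ᵛι· d≤t z = All.map⁺ (All.universal (p^∣ι* d≤t) z)

  p^1+d∣ᵛι·⇔p∣ᵛ : ∀ {d n} → suc d ≤ t → (z : Vec (Fin q) n) → p ^ suc d ∣ᵛ ι (p ^ d) · z ⇔ p ∣ᵛ z
  p^1+d∣ᵛι·⇔p∣ᵛ d<t z = mk⇔
    (λ p^1+d∣ → All.map (Equivalence.to (p^1+d∣ι*⇔p∣ d<t _)) (All.map⁻ p^1+d∣))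
    (λ p∣z → All.map⁺ (All.map (Equivalence.from (p^1+d∣ι*⇔p∣ d<t _)) p∣z))

  πᵛ≡0ᵛ⇔p∣ᵛ : ∀ {n} (z : Vec (Fin q) n) → φᵛ z ≡ replicate n 𝔽.0# ⇔ p ∣ᵛ z
  πᵛ≡0ᵛ⇔p∣ᵛ z = mk⇔ (⇒ z) (⇐ z)
    where
      ⇒ : ∀ {n} (z : Vec (Fin q) n) → φᵛ z ≡ replicate n 𝔽.0# → p ∣ᵛ z
      ⇒ []      _ = []
      ⇒ (a ∷ z) e = Equivalence.to (π≡0⇔p∣ a) (cong head e) ∷ ⇒ z (cong tail e)
      ⇐ : ∀ {n} (z : Vec (Fin q) n) → p ∣ᵛ z → φᵛ z ≡ replicate n 𝔽.0#
      ⇐ []      []         = refl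
      ⇐ (a ∷ z) (p∣a ∷ p∣z) = cong₂ _∷_ (Equivalence.from (π≡0⇔p∣ a) p∣a) (⇐ z p∣z)

  module _ {k : ℕ} (c : Vec (Fin q) (suc k)) where
    open Polynomials 𝔽ₚ.ring using (Poly; DegreeBelow; ∑<; ∑<-cong; toPoly; monomial; _⋆_)
    open IntegralDomain 𝔽ₚ.ring (φᵛ c) using (f; NontrivialFactorisation)
    open import Data.List as List using (List; []; _∷_; applyUpTo; upTo)
    open import Data.List.Properties using (map-upTo)
    open import Data.Product using (∃-syntax)
    open import Data.Sum using ([_,_]′)
    open import Data.Nat.ListAction using (sum)
    open import Relation.Nullary using (yes; no)
    open PolyModP p

    coeffList : Poly → List ℕ
    coeffList g = applyUpTo (toℕ ∘ g) (2 + k)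

    coeffAt-applyUpTo : ∀ (ψ : ℕ → ℕ) {n} i → i < n → coeffAt (applyUpTo ψ n) i ≡ ψ i
    coeffAt-applyUpTo ψ zero    (s≤s _)   = refl
    coeffAt-applyUpTo ψ (suc i) (s≤s i<n) = coeffAt-applyUpTo (ψ ∘ suc) i i<n

    coeffAt-applyUpTo-≥ : ∀ (ψ : ℕ → ℕ) n i → n ≤ i → coeffAt (applyUpTo ψ n) i ≡ 0
    coeffAt-applyUpTo-≥ ψ zero    i       _        = refl
    coeffAt-applyUpTo-≥ ψ (suc n) (suc i) (s≤s le) = coeffAt-applyUpTo-≥ (ψ ∘ suc) n i le

    coeffAt-coeffList : ∀ g → DegreeBelow (2 + k) g → ∀ i → coeffAt (coeffList g) i % p ≡ toℕ (g i)
    coeffAt-coeffList g g-degree i with i <? 2 + k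
    ... | yes i<N = trans (cong (_% p) (coeffAt-applyUpTo (toℕ ∘ g) i i<N)) (𝔽ₚ.toℕ%n (g i))
    ... | no  i≮N = begin
      coeffAt (coeffList g) i % p ≡⟨ cong (_% p) (coeffAt-applyUpTo-≥ (toℕ ∘ g) (2 + k) i (≮⇒≥ i≮N)) ⟩
      0 % p                       ≡⟨ 𝔽ₚ.0%n≡0 ⟩
      0                           ≡⟨ 𝔽ₚ.toℕ-0q ⟨
      toℕ 𝔽.0#                    ≡⟨ cong toℕ (g-degree i (≮⇒≥ i≮N)) ⟨
      toℕ (g i)                   ∎

    sum%p : ∀ n (ψ : ℕ → ℕ) → sum (applyUpTo ψ n) % p ≡ toℕ (∑< n (λ i → ψ i mod p))
    sum%p zero    ψ = trans 𝔽ₚ.0%n≡0 (sym 𝔽ₚ.toℕ-0q)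
    sum%p (suc n) ψ = begin
      (ψ 0 + sum (applyUpTo (ψ ∘ suc) n)) % p
        ≡⟨ %-distribˡ-+ (ψ 0) _ p ⟩
      (ψ 0 % p + sum (applyUpTo (ψ ∘ suc) n) % p) % p
        ≡⟨ cong₂ (λ u v → (u + v) % p) (sym (𝔽ₚ.toℕ-mod (ψ 0))) (sum%p n (ψ ∘ suc)) ⟩
      (toℕ (ψ 0 mod p) + toℕ (∑< n (λ i → ψ (suc i) mod p))) % p
        ≡⟨ 𝔽ₚ.toℕ-+q (ψ 0 mod p) (∑< n (λ i → ψ (suc i) mod p)) ⟨
      toℕ (∑< (suc n) (λ i → ψ i mod p)) ∎

    mulCoeff%p : ∀ g h → DegreeBelow (2 + k) g → DegreeBelow (2 + k) h →
                 ∀ i → mulCoeff (coeffList g) (coeffList h) i % p ≡ toℕ ((g ⋆ h) i)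
    mulCoeff%p g h g-degree h-degree i = begin
      sum (List.map ψ (upTo (suc i))) % p        ≡⟨ cong (λ l → sum l % p) (map-upTo ψ (suc i)) ⟩
      sum (applyUpTo ψ (suc i)) % p             ≡⟨ sum%p (suc i) ψ ⟩
      toℕ (∑< (suc i) (λ j → ψ j mod p))        ≡⟨ cong toℕ (∑<-cong (suc i) (λ j _ → 𝔽ₚ.mod-cong (product%p j))) ⟩
      toℕ ((g ⋆ h) i)                           ∎
      where
        ψ = λ j → coeffAt (coeffList g) j * coeffAt (coeffList h) (i ∸ j)
        product%p : ∀ j → ψ j % p ≡ (toℕ (g j) * toℕ (h (i ∸ j))) % p
        product%p j = trans (%-distribˡ-* _ _ p)
          (cong₂ (λ u v → (u * v) % p) (coeffAt-coeffList g g-degree j) (coeffAt-coeffList h h-degree (i ∸ j)))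

    monicCoeffs%p : ∀ {n} (v : Vec (Fin q) n) i →
                    coeffAt (List.map toℕ (Data.Vec.toList v) List.++ 1 ∷ []) i % p ≡ toℕ (toPoly (φᵛ v) i 𝔽.+ monomial n i)
    monicCoeffs%p []      zero    = trans (sym (𝔽ₚ.toℕ-mod 1)) (cong toℕ (sym (𝔽.+-identityˡ 𝔽.1#)))
    monicCoeffs%p []      (suc i) = trans 𝔽ₚ.0%n≡0 (trans (sym 𝔽ₚ.toℕ-0q) (cong toℕ (sym (𝔽.+-identityˡ 𝔽.0#))))
    monicCoeffs%p (a ∷ v) zero    = trans (sym (toℕ-π a)) (cong toℕ (sym (𝔽.+-identityʳ (π a))))
    monicCoeffs%p (a ∷ v) (suc i) = monicCoeffs%p v i

    nonconstant⇒¬unit : ∀ g → DegreeBelow (2 + k) g → ∃[ i ] 1 ≤ i × g i ≡ 𝔽.1# → ¬ IsUnitₚ (coeffList g)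
    nonconstant⇒¬unit g g-degree (suc i , _ , gᵢ≡1) (_ , higher≡0) = 1≢0 (begin
      1                               ≡⟨ 𝔽ₚ.toℕ-1q ⟨
      toℕ 𝔽.1#                        ≡⟨ cong toℕ gᵢ≡1 ⟨
      toℕ (g (suc i))                 ≡⟨ coeffAt-coeffList g g-degree (suc i) ⟨
      coeffAt (coeffList g) (suc i) % p ≡⟨ higher≡0 i ⟩
      0                               ∎)
      where
        1≢0 : 1 ≢ 0
        1≢0 ()

    irreducible⇒noNontrivialFactorisation : IrredModP p pp t (suc k) c → ¬ NontrivialFactorisation
    irreducible⇒noNontrivialFactorisation (_ , _ , factors-trivially) fact =
      [ nonconstant⇒¬unit g g-degree g-nonconstant , nonconstant⇒¬unit h h-degree h-nonconstant ]′
        (factors-trivially (coeffList g) (coeffList h) isProduct)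
      where
        open NontrivialFactorisation fact
        isProduct : IsProductₚ (monicCoeffs c) (coeffList g) (coeffList h)
        isProduct i = begin
          coeffAt (monicCoeffs c) i % p               ≡⟨ monicCoeffs%p c i ⟩
          toℕ (f i)                                   ≡⟨ cong toℕ (f≡g⋆h i) ⟩
          toℕ ((g ⋆ h) i)                             ≡⟨ mulCoeff%p g h g-degree h-degree i ⟨
          mulCoeff (coeffList g) (coeffList h) i % p  ∎

  module Lifting {k : ℕ} (c : Vec (Fin q) (suc k)) (irr : IrredModP p pp t (suc k) c) where
    open QuotientRing ℤq.ring c using (V; _⊛_; ⊛-·ˡ; ring)
    module R = CommutativeRing≡ ring
    module R̄ = CommutativeRing≡ (QuotientRing.ring 𝔽ₚ.ring (φᵛ c))

    reduction-noZeroDivisors : ∀ r̄ ū → r̄ ≢ R̄.0# → ū R̄.* r̄ ≡ R̄.0# → ū ≡ R̄.0#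
    reduction-noZeroDivisors = IntegralDomain.noZeroDivisors 𝔽ₚ.ring (φᵛ c) _≟_ 𝔽ₚ.*q-inverse
      (irreducible⇒noNontrivialFactorisation c irr)

    module _ (r : V) (πr≢0 : φᵛ r ≢ R̄.0#) where
      p^∣ᵛ-cancelʳ : ∀ d → d ≤ t → ∀ x → p ^ d ∣ᵛ x ⊛ r → p ^ d ∣ᵛ x
      p^∣ᵛ-cancelʳ zero    _   x _ = All.universal (λ a → 1∣ toℕ a) x
      p^∣ᵛ-cancelʳ (suc d) d<t x p^1+d∣x⊛r = subst (p ^ suc d ∣ᵛ_) (sym x≡p^d·y)
          (Equivalence.from (p^1+d∣ᵛι·⇔p∣ᵛ d<t y) (Equivalence.to (πᵛ≡0ᵛ⇔p∣ᵛ y) πy≡0))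
        where
          p^d∣x = p^∣ᵛ-cancelʳ d (≤-trans (n≤1+n d) d<t) x (∣ᵛ-weaken (p^-mono-∣ (n≤1+n d)) p^1+d∣x⊛r)
          y = map (quotientBy d) x
          x≡p^d·y : x ≡ ι (p ^ d) · y
          x≡p^d·y = p^∣ᵛ⇒≡ι· d x p^d∣x
          p∣y⊛r : p ∣ᵛ y ⊛ r
          p∣y⊛r = Equivalence.to (p^1+d∣ᵛι·⇔p∣ᵛ d<t (y ⊛ r))
            (subst (p ^ suc d ∣ᵛ_) (trans (cong (_⊛ r) x≡p^d·y) (⊛-·ˡ r (ι (p ^ d)) y)) p^1+d∣x⊛r)
          πy≡0 : φᵛ y ≡ R̄.0#
          πy≡0 = reduction-noZeroDivisors (φᵛ r) (φᵛ y) πr≢0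
            (trans (sym (φᵛ-⊛ c y r)) (Equivalence.from (πᵛ≡0ᵛ⇔p∣ᵛ (y ⊛ r)) p∣y⊛r))

      ⊛-cancelʳ : ∀ x y → x ⊛ r ≡ y ⊛ r → x ≡ y
      ⊛-cancelʳ x y x⊛r≡y⊛r = R.x∙y⁻¹≈ε⇒x≈y x y (q∣ᵛ⇒0ᵛ (x R.- y) (p^∣ᵛ-cancelʳ t ≤-refl (x R.- y)
        (subst (q ∣ᵛ_) (sym (trans (R.[y-z]x≈yx-zx r x y) (R.x≈y⇒x∙y⁻¹≈ε x⊛r≡y⊛r))) (0ᵛ-divisible q))))

  infix 4 _≟ᵛ_
  _≟ᵛ_ : ∀ {n} → DecidableEquality (Vec (Fin q) n)
  _≟ᵛ_ = Data.Vec.Properties.≡-dec _≟_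

  module _ (i : ℕ) (i≤t : i ≤ t) where
    open Counting
    open import Data.List using (allFin; upTo; cartesianProductWith)
    open import Data.List.Membership.Propositional.Properties using (∈-allFin)
    import Data.List.Relation.Unary.All
    open import Data.List.Relation.Unary.Unique.Propositional.Properties using (allFin⁺)
    open import Data.Nat.ListAction using (sum)
    open import Relation.Nullary using (yes; no)

    pⁱ : Fin q
    pⁱ = ι (p ^ i)

    private
      instance
        _ = m^n≢0 p (t ∸ i)
        _ = m^n≢0 p i

      q≡pⁱ*pᵗ⁻ⁱ : q ≡ p ^ i * p ^ (t ∸ i)
      q≡pⁱ*pᵗ⁻ⁱ = trans (cong (p ^_) (sym (m+[n∸m]≡n i≤t))) (^-distribˡ-+-* p i (t ∸ i))

    pⁱ*≡0⇔ : ∀ y → pⁱ ℤ.* y ≡ ℤ.0# ⇔ p ^ (t ∸ i) ∣ toℕ y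
    pⁱ*≡0⇔ y = mk⇔
      (λ e → *-cancelˡ-∣ (p ^ i) (subst (_∣ p ^ i * toℕ y) q≡pⁱ*pᵗ⁻ⁱ
               (m%n≡0⇒n∣m _ q (trans (sym (toℕ-ι* (p ^ i) y)) (trans (cong toℕ e) ℤq.toℕ-0q)))))
      (λ d → toℕ-injective (trans (toℕ-ι* (p ^ i) y)
               (trans (n∣m⇒m%n≡0 _ q (subst (_∣ p ^ i * toℕ y) (sym q≡pⁱ*pᵗ⁻ⁱ) (*-monoʳ-∣ (p ^ i) d))) (sym ℤq.toℕ-0q))))

    count-pⁱ*≡ : ∀ c₀ → count (λ y → pⁱ ℤ.* y ≟ pⁱ ℤ.* c₀) (allFin q) ≡ p ^ i
    count-pⁱ*≡ c₀ = begin
      count (λ y → pⁱ ℤ.* y ≟ pⁱ ℤ.* c₀) (allFin q)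
        ≡⟨ count-∘-injective _≟_ (allFin⁺ q) ∈-allFin (λ y → pⁱ ℤ.* y ≟ pⁱ ℤ.* c₀) (ℤ._+ c₀) (ℤ.+-cancelʳ c₀ _ _) ⟨
      count (λ y → pⁱ ℤ.* (y ℤ.+ c₀) ≟ pⁱ ℤ.* c₀) (allFin q)
        ≡⟨ count-cong _ (λ y → pⁱ ℤ.* y ≟ ℤ.0#) (λ y → mk⇔
             (λ e → ℤ.+-identityˡ-unique _ _ (trans (sym (ℤ.distribˡ pⁱ y c₀)) e))
             (λ e → trans (ℤ.distribˡ pⁱ y c₀) (trans (cong (ℤ._+ pⁱ ℤ.* c₀) e) (ℤ.+-identityˡ _)))) (allFin q) ⟩
      count (λ y → pⁱ ℤ.* y ≟ ℤ.0#) (allFin q)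
        ≡⟨ count-cong _ ((p ^ (t ∸ i) ∣?_) ∘ toℕ) pⁱ*≡0⇔ (allFin q) ⟩
      count ((p ^ (t ∸ i) ∣?_) ∘ toℕ) (allFin q)
        ≡⟨ count-map (p ^ (t ∸ i) ∣?_) toℕ (allFin q) ⟨
      count (p ^ (t ∸ i) ∣?_) (Data.List.map toℕ (allFin q))
        ≡⟨ cong (count (p ^ (t ∸ i) ∣?_)) (allFin-toℕ q) ⟩
      count (p ^ (t ∸ i) ∣?_) (upTo q)
        ≡⟨ cong (λ n → count (p ^ (t ∸ i) ∣?_) (upTo n)) q≡pⁱ*pᵗ⁻ⁱ ⟩
      count (p ^ (t ∸ i) ∣?_) (upTo (p ^ i * p ^ (t ∸ i)))
        ≡⟨ count-∣-upTo (p ^ (t ∸ i)) (p ^ i) ⟩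
      p ^ i ∎

    count-pⁱ·≡ : ∀ {n} (c : Vec (Fin q) n) → count (λ y → pⁱ · y ≟ᵛ pⁱ · c) (allVec q n) ≡ (p ^ i) ^ n
    count-pⁱ·≡         []        = refl
    count-pⁱ·≡ {suc n} (c₀ ∷ c) = begin
      count P? (allVec q (suc n))
        ≡⟨ cong (count P?) (allVec-suc q n) ⟩
      count P? (cartesianProductWith _∷_ (allFin q) (allVec q n))
        ≡⟨ count-cartesianProductWith P? _∷_ (allFin q) (allVec q n) ⟩
      sum (Data.List.map (λ x → count (P? ∘ (x ∷_)) (allVec q n)) (allFin q))
        ≡⟨ sum-count-weighted Q? _ K fibre (allFin q) ⟩
      count Q? (allFin q) * K
        ≡⟨ cong (_* K) (count-pⁱ*≡ c₀) ⟩
      p ^ i * K ∎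
      where
        K = (p ^ i) ^ n
        P? = λ y → pⁱ · y ≟ᵛ pⁱ · (c₀ ∷ c)
        Q? = λ x → pⁱ ℤ.* x ≟ pⁱ ℤ.* c₀
        fibre : ∀ x → count (P? ∘ (x ∷_)) (allVec q n) ≡ count Q? Data.List.[ x ] * K
        fibre x with Q? x
        ... | yes e = trans (count-cong _ (λ y → pⁱ · y ≟ᵛ pⁱ · c) (λ y → mk⇔ Data.Vec.Properties.∷-injectiveʳ (cong₂ _∷_ e)) (allVec q n))
                            (trans (count-pⁱ·≡ c) (sym (+-identityʳ K)))
        ... | no ¬e = count-none _ (Data.List.Relation.Unary.All.universal (λ y e′ → ¬e (Data.Vec.Properties.∷-injectiveˡ e′)) (allVec q n))

module GeneralizedRelativeDifferenceSet
  (p : ℕ) (pp : Prime p) (p-odd : p ℕ.% 2 ≡ 1) (t : ℕ) (1≤t : 1 ≤ t)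
  {k : ℕ} (c : Vec (Fin (p ^ t)) (suc k)) (irreducible : IrredModP p pp t (suc k) c) where

  open import Data.Vec using ([]; _∷_)
  import Data.Vec
  open import Data.List using ([]; _∷_)
  import Data.List.Relation.Unary.All as All
  open import Data.List.Membership.Propositional.Properties using (∈-cartesianProduct⁺)
  open import Data.List.Relation.Unary.Unique.Propositional using (Unique)
  import Data.List.Relation.Unary.Unique.Propositional.Properties as Unique
  open import Data.Nat.ListAction using (sum)
  open import Data.Nat.Properties using (^-*-assoc; ≤-trans; n≮n)
  open import Data.Nat.DivMod using (n%n≡0)
  open import Data.Product using (∃-syntax)
  open import Data.Sum using (inj₁; inj₂)
  open import Function using (_∘_)
  open import Relation.Nullary.Decidable using (_×-dec_)
  open import Relation.Unary using (Decidable)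

  open GR p pp t (suc k) c using (G; _-G_; _≟G_; _*R_; _-R_; allR; allG; InS; InS?; νS; InIdeal; InR; IsGRDS)
  open Reduction p pp t 1≤t
  open Counting
  open QuotientRing ℤq.ring c using (V; _⊛_; ·≡⊛constant)
  open Lifting c irreducible using (module R; module R̄; ⊛-cancelʳ)
  open CommutativeRing≡-Properties (QuotientRing.ring ℤq.ring c)
  open import Algebra.Solver.Ring.NaturalCoefficients.Default (CommutativeRing.commutativeSemiring R.commutativeRing)
  module ℤᵛ = Vectors ℤq.ring
  open ≡-Reasoning

  xMul≡ : ∀ a → GR.xMul p pp t (suc k) c a ≡ Quotient.xMul ℤq.ring c a
  xMul≡ a with shiftUp ℤ.0# a
  ... | _ , _ = refl

  horner : ∀ {m} → V → Vec (Fin q) m → V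
  horner a = Data.Vec.foldr (λ _ → V) (λ bⱼ acc → bⱼ ℤᵛ.· a ℤᵛ.+ᵛ GR.xMul p pp t (suc k) c acc) ℤᵛ.0ᵛ

  horner≡⊛ : ∀ a {m} (b : Vec (Fin q) m) → horner a b ≡ a ⊛ b
  horner≡⊛ a []       = refl
  horner≡⊛ a (b₀ ∷ b) = cong (b₀ ℤᵛ.· a ℤᵛ.+ᵛ_) (trans (xMul≡ (horner a b)) (cong (Quotient.xMul ℤq.ring c) (horner≡⊛ a b)))

  *R≡⊛ : ∀ a b → a *R b ≡ a ⊛ b
  *R≡⊛ a b = horner≡⊛ a b

  Solves : V → V → V → Set
  Solves a b x = (x *R x) -R b ≡ (x -R a) *R (x -R a)

  Solves? : ∀ a b → Decidable (Solves a b)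
  Solves? a b x = (x *R x) -R b ≟ᵛ (x -R a) *R (x -R a)

  allR-unique : Unique allR
  allR-unique = allVec-unique q (suc k)

  νS≡count-Solves : ∀ a b → νS (a , b) ≡ count (Solves? a b) allR
  νS≡count-Solves a b = begin
    νS (a , b)                                                         ≡⟨ count-cartesianProductWith _ _,_ allG allG ⟩
    sum (Data.List.map (λ u → count (λ v → Pair? (u , v)) allG) allG) ≡⟨ sum-count Q? _ fibre allG ⟩
    count Q? allG                                                      ≡⟨ count-cartesianProductWith Q? _,_ allR allR ⟩
    sum (Data.List.map (λ x → count (λ y → Q? (x , y)) allR) allR)    ≡⟨ sum-count (Solves? a b) _ fibre′ allR ⟩
    count (Solves? a b) allR                                           ∎
    where
      Pair? : Decidable (λ (uv : G × G) → InS (proj₁ uv) × InS (proj₂ uv) × (a , b) ≡ proj₁ uv -G proj₂ uv)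
      Pair? (u , v) = InS? u ×-dec InS? v ×-dec ((a , b) ≟G (u -G v))
      Q? : Decidable (λ u → InS u × InS (u -G (a , b)))
      Q? u = InS? u ×-dec InS? (u -G (a , b))
      fibre : ∀ u → count (λ v → Pair? (u , v)) allG ≡ count Q? (u ∷ [])
      fibre (x , y) = trans
        (count-only (λ v → Pair? ((x , y) , v)) ((x , y) -G (a , b)) (Unique.cartesianProduct⁺ allR-unique allR-unique)
          (∈-cartesianProduct⁺ (∈-allVec _) (∈-allVec _))
          (λ { (x′ , y′) (_ , _ , e) → cong₂ _,_ (x-y≡z⇒y≡x-z (sym (cong proj₁ e))) (x-y≡z⇒y≡x-z (sym (cong proj₂ e))) }))
        (count-singleton-cong (λ v → Pair? ((x , y) , v)) Q? (mk⇔ (λ { (Su , Sv , _) → Su , Sv })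
                                         (λ { (Su , Sv) → Su , Sv , sym (cong₂ _,_ (x-[x-y]≡y x a) (x-[x-y]≡y y b)) })))
      fibre′ : ∀ x → count (λ y → Q? (x , y)) allR ≡ count (Solves? a b) (x ∷ [])
      fibre′ x = trans
        (count-only (λ y → Q? (x , y)) (x *R x) allR-unique (∈-allVec (x *R x)) (λ _ → proj₁))
        (count-singleton-cong (λ y → Q? (x , y)) (Solves? a b) {x *R x} {x} (mk⇔ proj₂ (refl ,_)))

  Solves⇔ : ∀ a b x → Solves a b x ⇔ ((a R.+ a) R.* x ≡ a R.* a R.+ b)
  Solves⇔ a b x = Function.Properties.Equivalence.trans
    (≡-cong⇔ (cong (R._- b) (*R≡⊛ x x)) (*R≡⊛ (x R.- a) (x R.- a)))
    (xx-b≡[x-a][x-a]⇔[a+a]x≡aa+b x a b)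

  module Scaled (i : ℕ) (r x : V) where
    private
      P̂ : V
      P̂ = ι (p ^ i) ∷ ℤᵛ.0ᵛ
      a : V
      a = ι (p ^ i) ℤᵛ.· r
      ·≡⊛P̂ : ∀ v → ι (p ^ i) ℤᵛ.· v ≡ v ⊛ P̂
      ·≡⊛P̂ = ·≡⊛constant (ι (p ^ i))

    [a+a]x≡ : (a R.+ a) R.* x ≡ x ⊛ (r R.+ r) ⊛ P̂
    [a+a]x≡ = trans (cong (λ z → (z R.+ z) R.* x) (·≡⊛P̂ r)) (lemma r x P̂)
      where
        lemma : ∀ r x P̂ → (r R.* P̂ R.+ r R.* P̂) R.* x ≡ x R.* (r R.+ r) R.* P̂
        lemma = solve 3 (λ r x P̂ → (r :* P̂ :+ r :* P̂) :* x := x :* (r :+ r) :* P̂) refl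

    aa≡ : a R.* a ≡ a ⊛ r ⊛ P̂
    aa≡ = trans (cong (λ z → z R.* z) (·≡⊛P̂ r)) (trans (lemma r P̂) (cong (λ z → z R.* r R.* P̂) (sym (·≡⊛P̂ r))))
      where
        lemma : ∀ r P̂ → (r R.* P̂) R.* (r R.* P̂) ≡ (r R.* P̂) R.* r R.* P̂
        lemma = solve 2 (λ r P̂ → (r :* P̂) :* (r :* P̂) := (r :* P̂) :* r :* P̂) refl

    Solves-scaled⇔ : ∀ b′ → Solves a (ι (p ^ i) ℤᵛ.· b′) x ⇔ (ι (p ^ i) ℤᵛ.· (x ⊛ (r R.+ r)) ≡ ι (p ^ i) ℤᵛ.· (a ⊛ r R.+ b′))
    Solves-scaled⇔ b′ = Function.Properties.Equivalence.trans (Solves⇔ a b x)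
      (≡-cong⇔ (trans [a+a]x≡ (sym (·≡⊛P̂ (x ⊛ (r R.+ r)))))
               (trans (cong₂ R._+_ aa≡ (·≡⊛P̂ b′)) (trans (sym (R.distribʳ P̂ (a ⊛ r) b′)) (sym (·≡⊛P̂ (a ⊛ r R.+ b′))))))
      where b = ι (p ^ i) ℤᵛ.· b′

    Solves⇒b≡ : ∀ {b} → Solves a b x → b ≡ ι (p ^ i) ℤᵛ.· (x ⊛ (r R.+ r) R.- a ⊛ r)
    Solves⇒b≡ {b} sol = begin
      b
        ≡⟨ Equivalence.from (-‿shift⇔ _ _ b) (trans (Equivalence.to (Solves⇔ a b x) sol) (R.+-comm _ b)) ⟨
      (a R.+ a) R.* x R.- a R.* a
        ≡⟨ cong₂ R._-_ [a+a]x≡ aa≡ ⟩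
      x ⊛ (r R.+ r) ⊛ P̂ R.- a ⊛ r ⊛ P̂
        ≡⟨ R.[y-z]x≈yx-zx P̂ (x ⊛ (r R.+ r)) (a ⊛ r) ⟨
      (x ⊛ (r R.+ r) R.- a ⊛ r) ⊛ P̂
        ≡⟨ ·≡⊛P̂ (x ⊛ (r R.+ r) R.- a ⊛ r) ⟨
      ι (p ^ i) ℤᵛ.· (x ⊛ (r R.+ r) R.- a ⊛ r) ∎

  doubling-preserves-unit : ∀ r → φᵛ r ≢ R̄.0# → φᵛ (r R.+ r) ≢ R̄.0#
  doubling-preserves-unit r πr≢0 π2r≡0 = πr≢0 (begin
    v
      ≡⟨ 𝔽ᵛ.·-identityˡ v ⟨
    𝔽.1# 𝔽ᵛ.· v
      ≡⟨ cong (𝔽ᵛ._· v) (proj₂ (𝔽ₚ.*q-inverse two two≢0)) ⟨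
    (½ 𝔽.* two) 𝔽ᵛ.· v
      ≡⟨ 𝔽ᵛ.·-assoc ½ two v ⟨
    ½ 𝔽ᵛ.· (two 𝔽ᵛ.· v)
      ≡⟨ cong (½ 𝔽ᵛ.·_) (trans (𝔽ᵛ.·-distribʳ-+ 𝔽.1# 𝔽.1# v) (cong₂ 𝔽ᵛ._+ᵛ_ (𝔽ᵛ.·-identityˡ v) (𝔽ᵛ.·-identityˡ v))) ⟩
    ½ 𝔽ᵛ.· (v 𝔽ᵛ.+ᵛ v)
      ≡⟨ cong (½ 𝔽ᵛ.·_) (trans (sym (φᵛ-+ᵛ r r)) π2r≡0) ⟩
    ½ 𝔽ᵛ.· R̄.0#
      ≡⟨ 𝔽ᵛ.·-zeroʳ ½ ⟩
    R̄.0# ∎)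
    where
      module 𝔽ᵛ = Vectors 𝔽ₚ.ring
      v = φᵛ r
      two = 𝔽.1# 𝔽.+ 𝔽.1#
      two≢0 = 𝔽ₚ.odd⇒1+1≢0 p-odd
      ½ = proj₁ (𝔽ₚ.*q-inverse two two≢0)

  count-Solves : ∀ i → i ≤ t → ∀ r b′ → φᵛ r ≢ R̄.0# →
                 count (Solves? (ι (p ^ i) ℤᵛ.· r) (ι (p ^ i) ℤᵛ.· b′)) allR ≡ p ^ (i ℕ.* suc k)
  count-Solves i i≤t r b′ πr≢0 = begin
    count (Solves? a (ι (p ^ i) ℤᵛ.· b′)) allR
      ≡⟨ count-cong _ (F? ∘ (_⊛ (r R.+ r))) (λ x → Scaled.Solves-scaled⇔ i r x b′) allR ⟩
    count (F? ∘ (_⊛ (r R.+ r))) allR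
      ≡⟨ count-∘-injective _≟ᵛ_ allR-unique ∈-allVec F? (_⊛ (r R.+ r))
           (⊛-cancelʳ (r R.+ r) (doubling-preserves-unit r πr≢0) _ _) ⟩
    count F? allR
      ≡⟨ count-pⁱ·≡ i i≤t (a ⊛ r R.+ b′) ⟩
    (p ^ i) ^ suc k
      ≡⟨ ^-*-assoc p i (suc k) ⟩
    p ^ (i ℕ.* suc k) ∎
    where
      a = ι (p ^ i) ℤᵛ.· r
      F? = λ y → ι (p ^ i) ℤᵛ.· y ≟ᵛ ι (p ^ i) ℤᵛ.· (a ⊛ r R.+ b′)

  InIdeal⇔p^∣ᵛ : ∀ {i} → i ≤ t → ∀ a → InIdeal i a ⇔ p ^ i ∣ᵛ a
  InIdeal⇔p^∣ᵛ {i} i≤t a = mk⇔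
    (λ { (r , a≡pⁱr) → subst (p ^ i ∣ᵛ_) (sym a≡pⁱr) (p^∣ᵛι· i≤t r) })
    (λ p^i∣a → Data.Vec.map (quotientBy i) a , p^∣ᵛ⇒≡ι· i a p^i∣a)

  ι[q]≡0 : ι q ≡ ℤ.0#
  ι[q]≡0 = ℤq.mod-cong (trans (n%n≡0 q) (sym ℤq.0%n≡0))

  InR⇒unit-multiple : ∀ {i a} → InR i a → ∃[ r ] a ≡ ι (p ^ i) ℤᵛ.· r × φᵛ r ≢ R̄.0#
  InR⇒unit-multiple {i} {a} (inj₁ (i<t , (r , a≡pⁱr) , a∉)) = r , a≡pⁱr , λ πr≡0 →
    a∉ (Equivalence.from (InIdeal⇔p^∣ᵛ i<t a)
      (subst (p ^ suc i ∣ᵛ_) (sym a≡pⁱr) (Equivalence.from (p^1+d∣ᵛι·⇔p∣ᵛ i<t r) (Equivalence.to (πᵛ≡0ᵛ⇔p∣ᵛ r) πr≡0))))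
  InR⇒unit-multiple (inj₂ (refl , a≡0)) = R.1# , a≡qr , π1≢0
    where
      a≡qr = trans a≡0 (sym (trans (cong (ℤᵛ._· R.1#) ι[q]≡0) (ℤᵛ.·-zeroˡ R.1#)))
      π1≢0 : φᵛ R.1# ≢ R̄.0#
      π1≢0 π1≡0 = 𝔽ₚ.1q≢0q (trans (sym π-1) (cong Data.Vec.head π1≡0))

  InR⇒multiple : ∀ {i j b} → i ≤ j → j ≤ t → InR j b → ∃[ b′ ] b ≡ ι (p ^ i) ℤᵛ.· b′
  InR⇒multiple {i} {j} {b} i≤j j≤t (inj₁ (_ , b∈pʲ , _)) = Data.Vec.map (quotientBy i) b ,
    p^∣ᵛ⇒≡ι· i b (∣ᵛ-weaken (p^-mono-∣ i≤j) (Equivalence.to (InIdeal⇔p^∣ᵛ j≤t b) b∈pʲ))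
  InR⇒multiple {i} _ _ (inj₂ (refl , b≡0)) = ℤᵛ.0ᵛ , trans b≡0 (sym (ℤᵛ.·-zeroʳ (ι (p ^ i))))

  InR⇒¬p^∣ᵛ : ∀ {i j b} → j < i → i ≤ t → InR j b → ¬ p ^ i ∣ᵛ b
  InR⇒¬p^∣ᵛ j<i i≤t (inj₂ (refl , _))      _      = n≮n _ (≤-trans j<i i≤t)
  InR⇒¬p^∣ᵛ {b = b} j<i i≤t (inj₁ (_ , _ , b∉)) p^i∣b =
    b∉ (Equivalence.from (InIdeal⇔p^∣ᵛ (≤-trans j<i i≤t) b) (∣ᵛ-weaken (p^-mono-∣ j<i) p^i∣b))

  isGRDS : IsGRDS
  isGRDS a b i j i≤t j≤t a∈Rᵢ b∈Rⱼ = i≤j-case , j<i-case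
    where
      r = proj₁ (InR⇒unit-multiple a∈Rᵢ)
      a≡pⁱr = proj₁ (proj₂ (InR⇒unit-multiple a∈Rᵢ))
      πr≢0 = proj₂ (proj₂ (InR⇒unit-multiple a∈Rᵢ))

      i≤j-case : i ≤ j → νS (a , b) ≡ p ^ (i ℕ.* suc k)
      i≤j-case i≤j = begin
        νS (a , b)                                                  ≡⟨ νS≡count-Solves a b ⟩
        count (Solves? a b) allR                                    ≡⟨ cong₂ (λ a b → count (Solves? a b) allR) a≡pⁱr b≡pⁱb′ ⟩
        count (Solves? (ι (p ^ i) ℤᵛ.· r) (ι (p ^ i) ℤᵛ.· b′)) allR ≡⟨ count-Solves i i≤t r b′ πr≢0 ⟩
        p ^ (i ℕ.* suc k)                                           ∎
        where
          b′ = proj₁ (InR⇒multiple i≤j j≤t b∈Rⱼ)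
          b≡pⁱb′ = proj₂ (InR⇒multiple i≤j j≤t b∈Rⱼ)

      j<i-case : j < i → νS (a , b) ≡ 0
      j<i-case j<i = trans (νS≡count-Solves a b) (count-none (Solves? a b) (All.universal no-solution allR))
        where
          no-solution : ∀ x → ¬ Solves a b x
          no-solution x sol = InR⇒¬p^∣ᵛ j<i i≤t b∈Rⱼ (subst (p ^ i ∣ᵛ_) (sym b≡) (p^∣ᵛι· i≤t _))
            where b≡ = Scaled.Solves⇒b≡ i r x (subst (λ a → Solves a b x) a≡pⁱr sol)

proposition3p14 : (p : ℕ) (pp : Prime p) → p % 2 ≡ 1 → (t s : ℕ) → 1 ≤ t →
    (c : Vec (Fin (p ^ t)) s) → IrredModP p pp t s c → GR.IsGRDS p pp t s c
proposition3p14 p pp p-odd t zero    1≤t Vec.[] (_ , ¬unit , _) = contradiction (PrimeField.1-isUnit p pp) ¬unit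
proposition3p14 p pp p-odd t (suc k) 1≤t c irreducible =
  GeneralizedRelativeDifferenceSet.isGRDS p pp p-odd t 1≤t c irreducible
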